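{- Let $\mathbf a=(a_\ell)_{\ell\ge0}$, $\mathbf b=(b_{\ell,\ell'})_{\ell,\ell'\ge0}$ and $\lambda$ be indeterminates, and for $n,k\ge0$ let $$\widetilde Q_{n,k}=\sum_{G\in\mathbf{LD}^{\rm alt\infty}_{n,k}}\lambda^{\mathrm{cyc}(G)}\prod_{i\in\mathrm{Val}(G)}a_{\mathrm{ulev}(i,G)}\prod_{i\in\mathrm{Peak}(G)}b_{\mathrm{lcross}(i,G),\,\mathrm{lnest}(i,G)}.$$ Then for all $n,k\ge0$, $$\widetilde Q_{n+1,k}=a_{k-1}\,\widetilde Q_{n,k-1}+(\lambda+k)\Bigl(\sum_{i=0}^{k}b_{i,k-i}\Bigr)\widetilde Q_{n,k+1},$$ where the first term on the right is interpreted as $0$ when $k=0$.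
   Context: A Laguerre digraph on $[n]$ is a directed graph on vertex set $[n]$ (loops allowed) in which each vertex has in-degree 0 or 1 and out-degree 0 or 1; its components are directed paths (an isolated vertex counts as a path) and directed cycles (a loop counts as a cycle); $\mathrm{cyc}(G)$ is the number of cycles. Use $\infty$–$\infty$ boundary conditions: for $i\in[n]$, $p(i)$ is the predecessor of $i$ if $i$ has in-degree 1 and $p(i)=\infty$ otherwise; $s(i)$ is the successor if out-degree 1 and $s(i)=\infty$ otherwise, with $\infty$ larger than every integer. Vertex $i$ is a peak if $p(i)<i>s(i)$, a valley if $p(i)>i<s(i)$, a double ascent if $p(i)<i<s(i)$, a double descent if $p(i)>i>s(i)$, a fixed point if $p(i)=i=s(i)$; $\mathrm{Peak}(G)$, $\mathrm{Val}(G)$ are the sets of peaks and valleys. $G$ is alternating if it has no double ascents, double descents or fixed points; $\mathbf{LD}^{\rm alt\infty}_{n,k}$ is the set of such alternating Laguerre digraphs on $[n]$ with exactly $k$ paths ($\mathbf{LD}^{\rm alt\infty}_{0,0}$ contains only the empty digraph, and the set is empty if $k>n$). For $k\in[n]$: $\mathrm{lcross}(k,G)=\#\{(i,j,l): i,j\in[n],\ l\in[n]\cup\{\infty\},\ i<j<k<l,\ p(i)=k,\ p(j)=l\}$ and $\mathrm{lnest}(k,G)=\#\{(i,j,l): i,j\in[n],\ l\in[n]\cup\{\infty\},\ i<j<k<l,\ p(j)=k,\ p(i)=l\}$. For $j\in[n]$: $\mathrm{ulev}(j,G)=\#\{i\in[n]: i<j,\ j<s(i)\le\infty\}$ if $j<s(j)$,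 and $\mathrm{ulev}(j,G)=0$ otherwise. -}

module Defs where

open import Level using (Level)
open import Data.Nat as ℕ using (ℕ; zero; suc)
open import Data.Fin as Fin using (Fin; toℕ)
open import Data.Maybe using (Maybe; just; nothing)
open import Data.Bool using (Bool; true; false; _∧_; _∨_; not; if_then_else_)
open import Data.List using (List; []; _∷_; map; concatMap; filter; foldr; length; allFin; upTo)
open import Relation.Nullary.Decidable using (⌊_⌋)
open import Algebra.Bundles using (CommutativeSemiring)

-- Vertices: [n] is modelled by Fin n (order-preserving shift i ↦ i+1).
-- A Laguerre digraph is encoded by its successor map s : Fin n → Maybe (Fin n)
-- (nothing = out-degree 0 = "∞"), subject to injectivity (in-degree ≤ 1).

SuccMap : ℕ → Set
SuccMap n = Fin n → Maybe (Fin n)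

allFuns : {B : Set} (n : ℕ) → List B → List (Fin n → B)
allFuns zero    xs = (λ ()) ∷ []
allFuns (suc n) xs =
  concatMap (λ b → map (λ f → λ { Fin.zero → b ; (Fin.suc i) → f i }) (allFuns n xs)) xs

allExt : (n : ℕ) → List (Maybe (Fin n))
allExt n = nothing ∷ map just (allFin n)

eqF : {n : ℕ} → Fin n → Fin n → Bool
eqF i j = ⌊ i Fin.≟ j ⌋

eqM : {n : ℕ} → Maybe (Fin n) → Maybe (Fin n) → Bool
eqM nothing  nothing  = true
eqM (just i) (just j) = eqF i j
eqM _        _        = false

ltF : {n : ℕ} → Fin n → Fin n → Bool
ltF i j = ⌊ toℕ i ℕ.<? toℕ j ⌋

ltM : {n : ℕ} → Maybe (Fin n) → Maybe (Fin n) → Bool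
ltM (just i) (just j) = ltF i j
ltM (just i) nothing  = true
ltM nothing  _        = false

anyL : {A : Set} → (A → Bool) → List A → Bool
anyL P = foldr (λ x r → P x ∨ r) false

allL : {A : Set} → (A → Bool) → List A → Bool
allL P = foldr (λ x r → P x ∧ r) true

count : {A : Set} → (A → Bool) → List A → ℕ
count P xs = length (filter (λ x → P x Data.Bool.≟ true) xs)

-- injectivity of s on vertices with out-degree 1 (so every in-degree ≤ 1)
isLaguerre : {n : ℕ} → SuccMap n → Bool
isLaguerre {n} s =
  allL (λ i → allL (λ j → eqF i j ∨ not (ltM (s i) nothing ∧ eqM (s i) (s j))) (allFin n)) (allFin n)

predL : {n : ℕ} → SuccMap n → Fin n → List (Fin n) → Maybe (Fin n)
predL s i []       = nothing
predL s i (j ∷ js) = if eqM (s j) (just i) then just j else predL s i js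

p : {n : ℕ} → SuccMap n → Fin n → Maybe (Fin n)
p {n} s i = predL s i (allFin n)

isPeak isValley isDAsc isDDesc isFixed : {n : ℕ} → SuccMap n → Fin n → Bool
isPeak   s i = ltM (p s i) (just i) ∧ ltM (s i) (just i)
isValley s i = ltM (just i) (p s i) ∧ ltM (just i) (s i)
isDAsc   s i = ltM (p s i) (just i) ∧ ltM (just i) (s i)
isDDesc  s i = ltM (just i) (p s i) ∧ ltM (s i) (just i)
isFixed  s i = eqM (p s i) (just i) ∧ eqM (s i) (just i)

isAlternating : {n : ℕ} → SuccMap n → Bool
isAlternating {n} s =
  allL (λ i → not (isDAsc s i ∨ isDDesc s i ∨ isFixed s i)) (allFin n)

-- number of path components = number of vertices of in-degree 0
-- (each directed path, including an isolated vertex, has exactly one start;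
--  cycles have none)
paths : {n : ℕ} → SuccMap n → ℕ
paths {n} s = count (λ i → eqM (p s i) nothing) (allFin n)

iter : {n : ℕ} → SuccMap n → ℕ → Fin n → Maybe (Fin n)
iter s zero    i = just i
iter s (suc m) i with iter s m i
... | nothing = nothing
... | just j  = s j

steps : ℕ → List ℕ
steps n = map suc (upTo n)

onCycle : {n : ℕ} → SuccMap n → Fin n → Bool
onCycle {n} s i = anyL (λ m → eqM (iter s m i) (just i)) (steps n)

minOfOrbit : {n : ℕ} → SuccMap n → Fin n → Bool
minOfOrbit {n} s i = allL (λ m → not (ltM (iter s m i) (just i))) (steps n)

-- number of cycles = number of cycles' minimal vertices
cyc : {n : ℕ} → SuccMap n → ℕ
cyc {n} s = count (λ i → onCycle s i ∧ minOfOrbit s i) (allFin n)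

lcross : {n : ℕ} → SuccMap n → Fin n → ℕ
lcross {n} s k =
  foldr ℕ._+_ 0 (map (λ i → foldr ℕ._+_ 0 (map (λ j →
    count (λ l → ltF i j ∧ ltF j k ∧ ltM (just k) l ∧ eqM (p s i) (just k) ∧ eqM (p s j) l)
          (allExt n)) (allFin n))) (allFin n))

lnest : {n : ℕ} → SuccMap n → Fin n → ℕ
lnest {n} s k =
  foldr ℕ._+_ 0 (map (λ i → foldr ℕ._+_ 0 (map (λ j →
    count (λ l → ltF i j ∧ ltF j k ∧ ltM (just k) l ∧ eqM (p s j) (just k) ∧ eqM (p s i) l)
          (allExt n)) (allFin n))) (allFin n))

ulev : {n : ℕ} → SuccMap n → Fin n → ℕ
ulev {n} s j =
  if ltM (just j) (s j)
  then count (λ i → ltF i j ∧ ltM (just j) (s i)) (allFin n)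
  else 0

LDalt : (n k : ℕ) → List (SuccMap n)
LDalt n k = filter (λ s → (isLaguerre s ∧ isAlternating s ∧ ⌊ paths s ℕ.≟ k ⌋) Data.Bool.≟ true)
                   (allFuns n (allExt n))

module _ {c ℓ : Level} (R : CommutativeSemiring c ℓ) where
  open CommutativeSemiring R

  sumR : List Carrier → Carrier
  sumR = foldr _+_ 0#

  prodR : List Carrier → Carrier
  prodR = foldr _*_ 1#

  powR : Carrier → ℕ → Carrier
  powR x zero    = 1#
  powR x (suc m) = x * powR x m

  natR : ℕ → Carrier
  natR zero    = 0#
  natR (suc m) = 1# + natR m

  weight : (a : ℕ → Carrier) (b : ℕ → ℕ → Carrier) (λ' : Carrier)
           {n : ℕ} → SuccMap n → Carrier
  weight a b λ' {n} s =
    powR λ' (cyc s)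
    * (prodR (map (λ i → a (ulev s i)) (filter (λ i → isValley s i Data.Bool.≟ true) (allFin n)))
    *  prodR (map (λ i → b (lcross s i) (lnest s i)) (filter (λ i → isPeak s i Data.Bool.≟ true) (allFin n))))

  Qt : (a : ℕ → Carrier) (b : ℕ → ℕ → Carrier) (λ' : Carrier) (n k : ℕ) → Carrier
  Qt a b λ' n k = sumR (map (weight a b λ') (LDalt n k))

  bDiag : (b : ℕ → ℕ → Carrier) (k : ℕ) → Carrier
  bDiag b k = sumR (map (λ i → b i (k ℕ.∸ i)) (upTo (suc k)))

  firstTerm : (a : ℕ → Carrier) (b : ℕ → ℕ → Carrier) (λ' : Carrier) (n k : ℕ) → Carrier
  firstTerm a b λ' n zero    = 0#
  firstTerm a b λ' n (suc k) = a k * Qt a b λ' n k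

{-# OPTIONS --safe #-}
-- Classify G ∈ LD^{alt∞}_{n+1,k} by its largest vertex n+1.  As G is alternating, n+1 is either
-- a valley with p = s = ∞ (an isolated vertex) or a peak x → n+1 → y, and deleting it is a bijection
--   (A) onto LD^{alt∞}_{n,k-1}; the new valley has ulev = #path ends = k-1, contributing a_{k-1};
--   (B) onto the triples (H, x, y) with H ∈ LD^{alt∞}_{n,k+1}, x the end and y the start of a path of H.
-- The statistics of the old vertices do not change, because n+1 and ∞ compare alike with them.
-- In (B) the edges x → n+1 → y close a cycle exactly when x ends the path of y, so the k+1 choices of x
-- contribute λ + k; and lcross, lnest of the new peak count the starts after and before y, which is
-- (k - r, r) for the rank r of y among the k+1 starts, so the choices of y contribute Σ_i b_{i,k-i}.
module Submission where

open import Defs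
open import Level using (Level)
open import Data.Nat as ℕ using (ℕ; zero; suc; _∸_; _<_; _≤_; z≤n; s≤s)
import Data.Nat.Properties as NP
open import Data.Nat.Induction using (<-wellFounded)
open import Induction.WellFounded using (Acc; acc)
open import Data.Fin as Fin using (Fin; toℕ; inject₁; fromℕ)
import Data.Fin.Properties as FP
open import Data.Maybe as Maybe using (Maybe; just; nothing; fromMaybe)
open import Data.List using (List; []; _∷_; map; concatMap; filter; foldr; allFin; upTo; applyUpTo; tabulate; _++_)
import Data.List.Properties as LP
open import Data.List.Membership.Propositional using (_∈_)
open import Data.List.Membership.Propositional.Properties using (∈-allFin; ∈-map⁺; ∈-map⁻; ∈-upTo⁺; ∈-upTo⁻)
open import Data.List.Relation.Unary.Any using (here; there)
open import Data.Bool as B using (Bool; true; false; _∧_; _∨_; not; if_then_else_)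
import Data.Bool.Properties as BP
open import Data.Product using (∃; _×_; _,_; proj₁; proj₂)
open import Data.Sum using (_⊎_; inj₁; inj₂)
open import Data.Empty using (⊥; ⊥-elim)
open import Function using (_∘_)
open import Relation.Nullary using (¬_; yes; no)
open import Relation.Nullary.Decidable using (⌊_⌋)
open import Relation.Binary using (tri<; tri≈; tri>)
open import Relation.Binary.PropositionalEquality as P using (_≡_; _≢_)
open import Algebra.Bundles using (CommutativeMonoid; CommutativeSemiring)

module Fold {c ℓ : Level} (M : CommutativeMonoid c ℓ) where
  open CommutativeMonoid M
  open import Relation.Binary.Reasoning.Setoid setoid
  open import Algebra.Properties.CommutativeSemigroup commutativeSemigroup using (interchange)

  fold : {A : Set} → List A → (A → Carrier) → Carrier
  fold xs f = foldr _∙_ ε (map f xs)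

  fold-cong : {A : Set} (xs : List A) {f g : A → Carrier} → (∀ x → f x ≈ g x) → fold xs f ≈ fold xs g
  fold-cong [] e = refl
  fold-cong (x ∷ xs) e = ∙-cong (e x) (fold-cong xs e)

  fold-∙ : {A : Set} (xs : List A) (f g : A → Carrier) → fold xs (λ x → f x ∙ g x) ≈ fold xs f ∙ fold xs g
  fold-∙ [] f g = sym (identityˡ ε)
  fold-∙ (x ∷ xs) f g = trans (∙-cong refl (fold-∙ xs f g)) (interchange (f x) (g x) (fold xs f) (fold xs g))

  fold-ε : {A : Set} (xs : List A) → fold xs (λ _ → ε) ≈ ε
  fold-ε [] = refl
  fold-ε (x ∷ xs) = trans (identityˡ _) (fold-ε xs)

  fold-++ : {A : Set} (xs ys : List A) (f : A → Carrier) → fold (xs ++ ys) f ≈ fold xs f ∙ fold ys f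
  fold-++ [] ys f = sym (identityˡ _)
  fold-++ (x ∷ xs) ys f = trans (∙-cong refl (fold-++ xs ys f)) (sym (assoc _ _ _))

  fold-concatMap : {A B : Set} (g : A → List B) (xs : List A) (f : B → Carrier) →
                fold (concatMap g xs) f ≈ fold xs (λ x → fold (g x) f)
  fold-concatMap g [] f = refl
  fold-concatMap g (x ∷ xs) f = trans (fold-++ (g x) (concatMap g xs) f) (∙-cong refl (fold-concatMap g xs f))

  fold-swap : {A B : Set} (xs : List A) (ys : List B) (f : A → B → Carrier) →
           fold xs (λ x → fold ys (f x)) ≈ fold ys (λ y → fold xs (λ x → f x y))
  fold-swap [] ys f = sym (fold-ε ys)
  fold-swap (x ∷ xs) ys f = trans (∙-cong refl (fold-swap xs ys f)) (sym (fold-∙ ys (f x) (λ y → fold xs (λ x → f x y))))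

  fold-filter : {A : Set} (P : A → Bool) (xs : List A) (f : A → Carrier) →
             fold (filter (λ x → P x B.≟ true) xs) f ≈ fold xs (λ x → if P x then f x else ε)
  fold-filter P [] f = refl
  fold-filter P (x ∷ xs) f with P x
  ... | true = ∙-cong refl (fold-filter P xs f)
  ... | false = trans (fold-filter P xs f) (sym (identityˡ _))

  fold-tabulate : {A : Set} (n : ℕ) (g : Fin n → A) (f : A → Carrier) → fold (tabulate g) f ≡ fold (allFin n) (f ∘ g)
  fold-tabulate zero g f = P.refl
  fold-tabulate (suc n) g f = P.cong (f (g Fin.zero) ∙_) (P.trans (fold-tabulate n (g ∘ Fin.suc) f) (P.sym (fold-tabulate n Fin.suc (f ∘ g))))

  fold-last : (n : ℕ) (f : Fin (suc n) → Carrier) →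
           fold (allFin (suc n)) f ≈ fold (allFin n) (f ∘ Fin.inject₁) ∙ f (Fin.fromℕ n)
  fold-last zero f = trans (identityʳ _) (sym (identityˡ _))
  fold-last (suc n) f = begin
      f Fin.zero ∙ fold (tabulate Fin.suc) f
    ≡⟨ P.cong (f Fin.zero ∙_) (fold-tabulate (suc n) Fin.suc f) ⟩
      f Fin.zero ∙ fold (allFin (suc n)) (f ∘ Fin.suc)
    ≈⟨ ∙-cong refl (fold-last n (f ∘ Fin.suc)) ⟩
      f Fin.zero ∙ (fold (allFin n) (f ∘ Fin.suc ∘ Fin.inject₁) ∙ f (Fin.fromℕ (suc n)))
    ≈⟨ sym (assoc _ _ _) ⟩
      (f Fin.zero ∙ fold (allFin n) (f ∘ Fin.suc ∘ Fin.inject₁)) ∙ f (Fin.fromℕ (suc n))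
    ≡⟨ P.cong (λ z → (f Fin.zero ∙ z) ∙ f (Fin.fromℕ (suc n))) (P.sym (fold-tabulate n Fin.suc (f ∘ Fin.inject₁))) ⟩
      fold (allFin (suc n)) (f ∘ Fin.inject₁) ∙ f (Fin.fromℕ (suc n))
    ∎

  fold-first : (n : ℕ) (f : Fin (suc n) → Carrier) →
           fold (allFin (suc n)) f ≡ f Fin.zero ∙ fold (allFin n) (f ∘ Fin.suc)
  fold-first n f = P.cong (f Fin.zero ∙_) (fold-tabulate n Fin.suc f)


module Sums where

  χ : Bool → ℕ
  χ true = 1
  χ false = 0

  module Sumℕ = Fold NP.+-0-commutativeMonoid

  sumℕ : {A : Set} → List A → (A → ℕ) → ℕ
  sumℕ = Sumℕ.fold

  sumℕ-cong : ∀ {A : Set} (xs : List A) {f g : A → ℕ} → (∀ x → f x ≡ g x) → sumℕ xs f ≡ sumℕ xs g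
  sumℕ-cong xs h = Sumℕ.fold-cong xs h

  sumℕ-0 : ∀ {A : Set} (xs : List A) {f : A → ℕ} → (∀ x → f x ≡ 0) → sumℕ xs f ≡ 0
  sumℕ-0 xs h = P.trans (sumℕ-cong xs h) (Sumℕ.fold-ε xs)

  count≡sumℕ : {A : Set} (P : A → Bool) (xs : List A) → count P xs ≡ sumℕ xs (χ ∘ P)
  count≡sumℕ P [] = P.refl
  count≡sumℕ P (x ∷ xs) with P x
  ... | true = P.cong suc (count≡sumℕ P xs)
  ... | false = count≡sumℕ P xs

  count-cong : {A : Set} {P Q : A → Bool} (xs : List A) → (∀ x → P x ≡ Q x) → count P xs ≡ count Q xs
  count-cong {P = P} {Q} xs e = P.trans (count≡sumℕ P xs) (P.trans (Sumℕ.fold-cong xs (λ x → P.cong χ (e x))) (P.sym (count≡sumℕ Q xs)))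

  module Semi {c ℓ : Level} (R : CommutativeSemiring c ℓ) where
    open CommutativeSemiring R
    open import Relation.Binary.Reasoning.Setoid setoid
    open Fold +-commutativeMonoid public using ()
      renaming ( fold to ∑; fold-cong to ∑-cong; fold-∙ to ∑-+; fold-ε to ∑-0; fold-concatMap to ∑-concatMap
               ; fold-swap to ∑-swap; fold-first to ∑-first; fold-filter to ∑-filter)
    open Fold *-commutativeMonoid public using ()
      renaming (fold to ∏; fold-cong to ∏-cong; fold-last to ∏-last; fold-filter to ∏-filter)

    when : Bool → Carrier → Carrier
    when b x = if b then x else 0#

    when-∧ : ∀ a b X → when (a ∧ b) X ≈ when a (when b X)
    when-∧ true b X = refl
    when-∧ false b X = refl

    when-comm : ∀ a b X → when a (when b X) ≈ when b (when a X)
    when-comm true b X = refl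
    when-comm false true X = refl
    when-comm false false X = refl

    when-*ˡ : ∀ a X Y → X * when a Y ≈ when a (X * Y)
    when-*ˡ true X Y = refl
    when-*ˡ false X Y = zeroʳ X

    when-*ʳ : ∀ a X Y → when a X * Y ≈ when a (X * Y)
    when-*ʳ true X Y = refl
    when-*ʳ false X Y = zeroˡ Y

    when-split : ∀ a c X → when a X ≈ when (a ∧ c) X + when (a ∧ not c) X
    when-split true true X = sym (+-identityʳ X)
    when-split true false X = sym (+-identityˡ X)
    when-split false c X = sym (+-identityˡ 0#)

    ∑-when : {A : Set} (xs : List A) (a : Bool) (f : A → Carrier) → ∑ xs (λ x → when a (f x)) ≈ when a (∑ xs f)
    ∑-when xs true f = refl
    ∑-when xs false f = ∑-0 xs

    ∑-map : {A B : Set} (g : A → B) (xs : List A) (f : B → Carrier) → ∑ (map g xs) f ≡ ∑ xs (f ∘ g)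
    ∑-map g [] f = P.refl
    ∑-map g (x ∷ xs) f = P.cong (f (g x) +_) (∑-map g xs f)

    natᴿ : ℕ → Carrier
    natᴿ = natR R

    ∑-*ˡ : {A : Set} (xs : List A) (a : Carrier) (f : A → Carrier) → a * ∑ xs f ≈ ∑ xs (λ x → a * f x)
    ∑-*ˡ [] a f = zeroʳ a
    ∑-*ˡ (x ∷ xs) a f = trans (distribˡ a (f x) (∑ xs f)) (+-cong refl (∑-*ˡ xs a f))

    ∑-*ʳ : {A : Set} (xs : List A) (a : Carrier) (f : A → Carrier) → ∑ xs f * a ≈ ∑ xs (λ x → f x * a)
    ∑-*ʳ xs a f = trans (*-comm _ _) (trans (∑-*ˡ xs a f) (∑-cong xs (λ x → *-comm a (f x))))

    nat-+ : (m n : ℕ) → natᴿ (m ℕ.+ n) ≈ natᴿ m + natᴿ n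
    nat-+ zero n = sym (+-identityˡ _)
    nat-+ (suc m) n = trans (+-cong refl (nat-+ m n)) (sym (+-assoc _ _ _))

    ∑-natR : {A : Set} (xs : List A) (f : A → ℕ) → natᴿ (sumℕ xs f) ≈ ∑ xs (λ x → natᴿ (f x))
    ∑-natR [] f = refl
    ∑-natR (x ∷ xs) f = trans (nat-+ (f x) (sumℕ xs f)) (+-cong refl (∑-natR xs f))

    when≈χ* : (b : Bool) (a : Carrier) → when b a ≈ natᴿ (χ b) * a
    when≈χ* true a = sym (trans (*-congʳ (+-identityʳ 1#)) (*-identityˡ a))
    when≈χ* false a = sym (zeroˡ a)

    ∑-when-const : {A : Set} (P : A → Bool) (xs : List A) (a : Carrier) →
                  ∑ xs (λ x → when (P x) a) ≈ natᴿ (count P xs) * a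
    ∑-when-const P xs a = begin
        ∑ xs (λ x → when (P x) a)
      ≈⟨ ∑-cong xs (λ x → when≈χ* (P x) a) ⟩
        ∑ xs (λ x → natᴿ (χ (P x)) * a)
      ≈⟨ sym (∑-*ʳ xs a _) ⟩
        ∑ xs (λ x → natᴿ (χ (P x))) * a
      ≈⟨ *-congʳ (sym (∑-natR xs (χ ∘ P))) ⟩
        natᴿ (sumℕ xs (χ ∘ P)) * a
      ≡⟨ P.cong (λ z → natᴿ z * a) (P.sym (count≡sumℕ P xs)) ⟩
        natᴿ (count P xs) * a
      ∎

    when-cong : (b : Bool) {x y : Carrier} → (b ≡ true → x ≈ y) → when b x ≈ when b y
    when-cong true e = e P.refl
    when-cong false e = refl

    ∑-unique : {A : Set} (P : A → Bool) (xs : List A) (f : A → Carrier) (a : Carrier) →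
               count P xs ≡ 1 → (∀ x → P x ≡ true → f x ≈ a) →
               ∑ xs (λ x → when (P x) (f x)) ≈ a
    ∑-unique P xs f a c1 e = begin
        ∑ xs (λ x → when (P x) (f x))
      ≈⟨ ∑-cong xs (λ x → when-cong (P x) (e x)) ⟩
        ∑ xs (λ x → when (P x) a)
      ≈⟨ ∑-when-const P xs a ⟩
        natᴿ (count P xs) * a
      ≡⟨ P.cong (λ z → natᴿ z * a) c1 ⟩
        (1# + 0#) * a
      ≈⟨ *-congʳ (+-identityʳ 1#) ⟩
        1# * a
      ≈⟨ *-identityˡ a ⟩
        a
      ∎

    ∑-none : {A : Set} (P : A → Bool) (xs : List A) (f : A → Carrier) →
               count P xs ≡ 0 → ∑ xs (λ x → when (P x) (f x)) ≈ 0#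
    ∑-none P [] f c0 = refl
    ∑-none P (x ∷ xs) f c0 with P x
    ... | true = ⊥-elim (NP.1+n≢0 c0)
    ... | false = trans (+-identityˡ _) (∑-none P xs f c0)

open Sums

module OrderLemmas where

  open P using (refl)

  ∧-true₁ : ∀ {a b} → a ∧ b ≡ true → a ≡ true
  ∧-true₁ {true} e = refl

  ∧-true₂ : ∀ {a b} → a ∧ b ≡ true → b ≡ true
  ∧-true₂ {true} e = e

  ∧-intro : ∀ {a b} → a ≡ true → b ≡ true → a ∧ b ≡ true
  ∧-intro refl refl = refl

  not-true : ∀ {a} → not a ≡ true → a ≡ false
  not-true {false} e = refl

  t≢f : true ≢ false
  t≢f ()

  ≢true : ∀ {a} → ¬ (a ≡ true) → a ≡ false
  ≢true = BP.¬-not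

  ltF-true : ∀ {n} {i j : Fin n} → ltF i j ≡ true → toℕ i < toℕ j
  ltF-true {i = i} {j} e with toℕ i ℕ.<? toℕ j
  ... | yes p = p

  ltF-intro : ∀ {n} {i j : Fin n} → toℕ i < toℕ j → ltF i j ≡ true
  ltF-intro {i = i} {j} h with toℕ i ℕ.<? toℕ j
  ... | yes _ = refl
  ... | no q = ⊥-elim (q h)

  ltF-false : ∀ {n} {i j : Fin n} → ¬ (toℕ i < toℕ j) → ltF i j ≡ false
  ltF-false {i = i} {j} h with toℕ i ℕ.<? toℕ j
  ... | yes q = ⊥-elim (h q)
  ... | no _ = refl

  ltF-irrefl : ∀ {n} (i : Fin n) → ltF i i ≡ false
  ltF-irrefl i = ltF-false (NP.<-irrefl refl)

  eqF-true : ∀ {n} {i j : Fin n} → eqF i j ≡ true → i ≡ j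
  eqF-true {i = i} {j} e with i Fin.≟ j
  ... | yes p = p

  eqF-refl : ∀ {n} (i : Fin n) → eqF i i ≡ true
  eqF-refl i with i Fin.≟ i
  ... | yes _ = refl
  ... | no q = ⊥-elim (q refl)

  eqF-intro : ∀ {n} {i j : Fin n} → i ≡ j → eqF i j ≡ true
  eqF-intro {i = i} refl = eqF-refl i

  eqF-false : ∀ {n} {i j : Fin n} → i ≢ j → eqF i j ≡ false
  eqF-false {i = i} {j} h with i Fin.≟ j
  ... | yes q = ⊥-elim (h q)
  ... | no _ = refl

  eqM-true : ∀ {n} {u v : Maybe (Fin n)} → eqM u v ≡ true → u ≡ v
  eqM-true {u = nothing} {nothing} e = refl
  eqM-true {u = just i} {just j} e = P.cong just (eqF-true e)

  eqM-refl : ∀ {n} (u : Maybe (Fin n)) → eqM u u ≡ true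
  eqM-refl nothing = refl
  eqM-refl (just i) = eqF-refl i

  eqM-false : ∀ {n} {u v : Maybe (Fin n)} → u ≢ v → eqM u v ≡ false
  eqM-false {u = nothing} {nothing} h = ⊥-elim (h refl)
  eqM-false {u = nothing} {just x} h = refl
  eqM-false {u = just x} {nothing} h = refl
  eqM-false {u = just i} {just j} h = eqF-false (λ e → h (P.cong just e))

  ι : ∀ {n} → Fin n → Fin (suc n)
  ι = inject₁

  ℓ : ∀ n → Fin (suc n)
  ℓ n = fromℕ n

  toℕ-ι : ∀ {n} (i : Fin n) → toℕ (ι i) ≡ toℕ i
  toℕ-ι = FP.toℕ-inject₁

  toℕ-ℓ : ∀ n → toℕ (ℓ n) ≡ n
  toℕ-ℓ = FP.toℕ-fromℕ

  ι-inj : ∀ {n} {i j : Fin n} → ι i ≡ ι j → i ≡ j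
  ι-inj {i = i} {j} e = FP.toℕ-injective (P.trans (P.sym (toℕ-ι i)) (P.trans (P.cong toℕ e) (toℕ-ι j)))

  ι≢ℓ : ∀ {n} (i : Fin n) → ι i ≢ ℓ n
  ι≢ℓ {n} i e = NP.<-irrefl (P.trans (P.sym (toℕ-ι i)) (P.trans (P.cong toℕ e) (toℕ-ℓ n))) (FP.toℕ<n i)

  data LastView {n : ℕ} : Fin (suc n) → Set where
    old : (i : Fin n) → LastView (ι i)
    new : LastView (ℓ n)

  lastView : ∀ {n} (j : Fin (suc n)) → LastView j
  lastView {zero} Fin.zero = new
  lastView {suc n} Fin.zero = old Fin.zero
  lastView {suc n} (Fin.suc j) with lastView j
  ... | old i = old (Fin.suc i)
  ... | new = new

  caseLast : ∀ {n} {A : Set} → (Fin n → A) → A → Fin (suc n) → A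
  caseLast {zero} f a _ = a
  caseLast {suc n} f a Fin.zero = f Fin.zero
  caseLast {suc n} f a (Fin.suc j) = caseLast (f ∘ Fin.suc) a j

  caseLast-ι : ∀ {n} {A : Set} (f : Fin n → A) (a : A) (i : Fin n) → caseLast f a (ι i) ≡ f i
  caseLast-ι {suc n} f a Fin.zero = refl
  caseLast-ι {suc n} f a (Fin.suc i) = caseLast-ι (f ∘ Fin.suc) a i

  caseLast-ℓ : ∀ {n} {A : Set} (f : Fin n → A) (a : A) → caseLast f a (ℓ n) ≡ a
  caseLast-ℓ {zero} f a = refl
  caseLast-ℓ {suc n} f a = caseLast-ℓ (f ∘ Fin.suc) a

  lift : ∀ {n} → Maybe (Fin n) → Maybe (Fin (suc n))
  lift = Maybe.map ι

  unlift : ∀ {n} → Maybe (Fin (suc n)) → Maybe (Fin n)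
  unlift nothing = nothing
  unlift (just j) = caseLast just nothing j

  unlift-lift : ∀ {n} (v : Maybe (Fin n)) → unlift (lift v) ≡ v
  unlift-lift nothing = refl
  unlift-lift (just i) = caseLast-ι just nothing i

  ltF-ι : ∀ {n} (i j : Fin n) → ltF (ι i) (ι j) ≡ ltF i j
  ltF-ι i j rewrite toℕ-ι i | toℕ-ι j = refl

  ltF-ιℓ : ∀ {n} (i : Fin n) → ltF (ι i) (ℓ n) ≡ true
  ltF-ιℓ {n} i = ltF-intro (P.subst₂ _<_ (P.sym (toℕ-ι i)) (P.sym (toℕ-ℓ n)) (FP.toℕ<n i))

  ltF-ℓ : ∀ {n} (j : Fin (suc n)) → ltF (ℓ n) j ≡ false
  ltF-ℓ {n} j = ltF-false (λ h → NP.<-irrefl refl (NP.<-≤-trans (P.subst (_< toℕ j) (toℕ-ℓ n) h) (ℕ.s≤s⁻¹ (FP.toℕ<n j))))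

  eqF-ι : ∀ {n} (i j : Fin n) → eqF (ι i) (ι j) ≡ eqF i j
  eqF-ι i j with i Fin.≟ j
  ... | yes refl = eqF-refl (ι i)
  ... | no h = eqF-false (λ e → h (ι-inj e))

  eqF-ιℓ : ∀ {n} (i : Fin n) → eqF (ι i) (ℓ n) ≡ false
  eqF-ιℓ i = eqF-false (ι≢ℓ i)

  eqF-ℓι : ∀ {n} (i : Fin n) → eqF (ℓ n) (ι i) ≡ false
  eqF-ℓι i = eqF-false (λ e → ι≢ℓ i (P.sym e))

  -- A neighbour of an old vertex in a digraph on [n+1] versus in its restriction to [n]:
  -- the new vertex n+1 becomes ∞, and both exceed every old vertex, so comparisons survive.
  data Agree {n : ℕ} : Maybe (Fin (suc n)) → Maybe (Fin n) → Set where
    agree : (j : Fin n) → Agree (just (ι j)) (just j)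
    both∞ : Agree nothing nothing
    last∞ : Agree (just (ℓ n)) nothing

  Agree-ltˡ : ∀ {n} {v v'} (c : Agree {n} v v') (i : Fin n) → ltM v (just (ι i)) ≡ ltM v' (just i)
  Agree-ltˡ (agree j) i = ltF-ι j i
  Agree-ltˡ both∞ i = refl
  Agree-ltˡ {n} last∞ i = ltF-ℓ (ι i)

  Agree-ltʳ : ∀ {n} {v v'} (c : Agree {n} v v') (i : Fin n) → ltM (just (ι i)) v ≡ ltM (just i) v'
  Agree-ltʳ (agree j) i = ltF-ι i j
  Agree-ltʳ both∞ i = refl
  Agree-ltʳ last∞ i = ltF-ιℓ i

  Agree-eq : ∀ {n} {v v'} (c : Agree {n} v v') (i : Fin n) → eqM v (just (ι i)) ≡ eqM v' (just i)
  Agree-eq (agree j) i = eqF-ι j i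
  Agree-eq both∞ i = refl
  Agree-eq last∞ i = eqF-ℓι i

  Agree-lift : ∀ {n} (v : Maybe (Fin n)) → Agree (lift v) v
  Agree-lift nothing = both∞
  Agree-lift (just j) = agree j

  Agree-unlift : ∀ {n} (v : Maybe (Fin (suc n))) → Agree v (unlift v)
  Agree-unlift nothing = both∞
  Agree-unlift (just j) with lastView j
  ... | old i = P.subst (Agree (just (ι i))) (P.sym (caseLast-ι just nothing i)) (agree i)
  ... | new = P.subst (Agree (just (ℓ _))) (P.sym (caseLast-ℓ just nothing)) last∞

open OrderLemmas

module ListPredicates where

  open import Data.Nat using (_+_)
  open P using (refl)

  bool-ext : ∀ {a b : Bool} → (a ≡ true → b ≡ true) → (b ≡ true → a ≡ true) → a ≡ b
  bool-ext {true} {true} f g = refl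
  bool-ext {true} {false} f g = P.sym (f refl)
  bool-ext {false} {true} f g = g refl
  bool-ext {false} {false} f g = refl

  allL-∈ : ∀ {A : Set} {P : A → Bool} {xs : List A} {x : A} → allL P xs ≡ true → x ∈ xs → P x ≡ true
  allL-∈ {P = P} {y ∷ xs} e (here refl) = ∧-true₁ {P y} e
  allL-∈ {P = P} {y ∷ xs} e (there m) = allL-∈ {P = P} (∧-true₂ {P y} e) m

  allL-intro : ∀ {A : Set} {P : A → Bool} (xs : List A) → (∀ x → x ∈ xs → P x ≡ true) → allL P xs ≡ true
  allL-intro [] h = refl
  allL-intro (x ∷ xs) h = ∧-intro (h x (here refl)) (allL-intro xs (λ y m → h y (there m)))

  anyL-∈ : ∀ {A : Set} {P : A → Bool} (xs : List A) → anyL P xs ≡ true → ∃ λ x → x ∈ xs × P x ≡ true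
  anyL-∈ {P = P} (y ∷ xs) e with P y in eq
  ... | true = y , here refl , eq
  ... | false with anyL-∈ {P = P} xs e
  ... | x , m , px = x , there m , px

  anyL-intro : ∀ {A : Set} {P : A → Bool} {xs : List A} {x : A} → x ∈ xs → P x ≡ true → anyL P xs ≡ true
  anyL-intro {P = P} {y ∷ xs} (here refl) px rewrite px = refl
  anyL-intro {P = P} {y ∷ xs} (there m) px with P y
  ... | true = refl
  ... | false = anyL-intro {P = P} m px

  allFin-all : ∀ {n} {P : Fin n → Bool} → allL P (allFin n) ≡ true → ∀ i → P i ≡ true
  allFin-all {P = P} e i = allL-∈ {P = P} e (∈-allFin i)

  allFin-intro : ∀ {n} {P : Fin n → Bool} → (∀ i → P i ≡ true) → allL P (allFin n) ≡ true
  allFin-intro {n} h = allL-intro (allFin n) (λ x _ → h x)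

  allL-last : ∀ {n} (P : Fin (suc n) → Bool) → allL P (allFin (suc n)) ≡ allL (P ∘ ι) (allFin n) ∧ P (ℓ n)
  allL-last {n} P = bool-ext
    (λ e → ∧-intro (allFin-intro {P = P ∘ ι} (λ i → allFin-all {P = P} e (ι i))) (allFin-all {P = P} e (ℓ n)))
    (λ e → allFin-intro {P = P} (λ j → f e j (lastView j)))
    where
      f : allL (P ∘ ι) (allFin n) ∧ P (ℓ n) ≡ true → (j : Fin (suc n)) → LastView j → P j ≡ true
      f e _ (old i) = allFin-all {P = P ∘ ι} (∧-true₁ e) i
      f e _ new = ∧-true₂ {allL (P ∘ ι) (allFin n)} e

  count-last : ∀ {n} (P : Fin (suc n) → Bool) → count P (allFin (suc n)) ≡ count (P ∘ ι) (allFin n) + χ (P (ℓ n))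
  count-last {n} P = P.trans (count≡sumℕ P (allFin (suc n)))
    (P.trans (Sumℕ.fold-last n (χ ∘ P)) (P.cong (_+ χ (P (ℓ n))) (P.sym (count≡sumℕ (P ∘ ι) (allFin n)))))

  count-false : ∀ {A : Set} {P : A → Bool} (xs : List A) → (∀ x → P x ≡ false) → count P xs ≡ 0
  count-false [] h = refl
  count-false {P = P} (x ∷ xs) h rewrite h x = count-false xs h

  count-first : ∀ {n} (P : Fin (suc n) → Bool) → count P (allFin (suc n)) ≡ χ (P Fin.zero) + count (P ∘ Fin.suc) (allFin n)
  count-first {n} P = P.trans (count≡sumℕ P (allFin (suc n)))
    (P.trans (Sumℕ.fold-first n (χ ∘ P)) (P.cong (χ (P Fin.zero) +_) (P.sym (count≡sumℕ (P ∘ Fin.suc) (allFin n)))))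

  count-unique : ∀ {n} (Q : Fin n → Bool) (w : Fin n) → (∀ j → j ≢ w → Q j ≡ false) → count Q (allFin n) ≡ χ (Q w)
  count-unique {suc n} Q Fin.zero h = P.trans (count-first Q)
    (P.trans (P.cong (χ (Q Fin.zero) +_) (count-false (allFin n) (λ j → h (Fin.suc j) (λ ())))) (NP.+-identityʳ _))
  count-unique {suc n} Q (Fin.suc w) h = P.trans (count-first Q)
    (P.trans (P.cong (_+ count (Q ∘ Fin.suc) (allFin n)) (P.cong χ (h Fin.zero (λ ()))))
       (count-unique (Q ∘ Fin.suc) w (λ j ne → h (Fin.suc j) (λ e → ne (FP.suc-injective e)))))

  count-∧-eqF : ∀ {n} (c : Bool) (w : Fin n) → count (λ j → c ∧ eqF j w) (allFin n) ≡ χ c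
  count-∧-eqF c w = P.trans (count-unique _ w (λ j j≢w → P.trans (P.cong (c ∧_) (eqF-false j≢w)) (BP.∧-zeroʳ c)))
                            (P.cong χ (P.trans (P.cong (c ∧_) (eqF-refl w)) (BP.∧-identityʳ c)))

  count-one : ∀ {n} (Q : Fin n → Bool) (w : Fin n) → Q w ≡ true → (∀ j → Q j ≡ true → j ≡ w) → count Q (allFin n) ≡ 1
  count-one Q w qw h = P.trans (count-unique Q w (λ j ne → ≢true (λ e → ne (h j e)))) (P.cong χ qw)

  count-zero : ∀ {A : Set} {P : A → Bool} (xs : List A) → count P xs ≡ 0 → ∀ x → x ∈ xs → P x ≡ false
  count-zero {P = P} (y ∷ xs) c x (here refl) with P y
  ... | false = refl
  count-zero {P = P} (y ∷ xs) c x (there m) with P y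
  ... | false = count-zero xs c x m

  count-splitBy : ∀ {A : Set} (H Q : A → Bool) (xs : List A) → count Q xs ≡ count (λ i → not (H i) ∧ Q i) xs + count (λ i → H i ∧ Q i) xs
  count-splitBy H Q xs = P.trans (count≡sumℕ Q xs) (P.trans (Sumℕ.fold-cong xs lem)
      (P.trans (Sumℕ.fold-∙ xs _ _) (P.cong₂ _+_ (P.sym (count≡sumℕ _ xs)) (P.sym (count≡sumℕ _ xs)))))
    where
      lem : ∀ i → χ (Q i) ≡ χ (not (H i) ∧ Q i) + χ (H i ∧ Q i)
      lem i with H i | Q i
      ... | true | true = refl
      ... | true | false = refl
      ... | false | true = refl
      ... | false | false = refl

  count+count-not : ∀ {A : Set} (Q : A → Bool) (xs : List A) → count Q xs + count (not ∘ Q) xs ≡ count (λ _ → true) xs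
  count+count-not Q xs = P.sym (P.trans (count-splitBy Q (λ _ → true) xs) (P.trans
      (P.cong₂ _+_ (count-cong xs (λ i → BP.∧-identityʳ _)) (count-cong xs (λ i → BP.∧-identityʳ _))) (NP.+-comm (count (λ i → not (Q i)) xs) (count Q xs))))

  count-map : ∀ {A B : Set} (Q : B → Bool) (g : A → B) (xs : List A) → count Q (map g xs) ≡ count (Q ∘ g) xs
  count-map Q g [] = refl
  count-map Q g (x ∷ xs) with Q (g x)
  ... | true = P.cong suc (count-map Q g xs)
  ... | false = count-map Q g xs

  count-allExt : ∀ {n} (Q : Maybe (Fin n) → Bool) → count Q (allExt n) ≡ χ (Q nothing) + count (Q ∘ just) (allFin n)
  count-allExt {n} Q with Q nothing
  ... | true = P.cong suc (count-map Q just (allFin n))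
  ... | false = count-map Q just (allFin n)

open ListPredicates

module SuccessorMaps where

  open import Data.Nat using (_+_)
  open P using (refl)

  Injective : ∀ {n} → SuccMap n → Set
  Injective {n} t = ∀ (i j : Fin n) (v : Fin n) → t i ≡ just v → t j ≡ just v → i ≡ j

  isLaguerre⇒Injective : ∀ {n} (t : SuccMap n) → isLaguerre t ≡ true → Injective t
  isLaguerre⇒Injective t e i j v ti tj with allFin-all (allFin-all e i) j
  ... | h rewrite ti | tj | eqF-refl v with eqF i j in eq
  ... | true = eqF-true eq

  Injective⇒isLaguerre : ∀ {n} (t : SuccMap n) → Injective t → isLaguerre t ≡ true
  Injective⇒isLaguerre t inj = allFin-intro (λ i → allFin-intro (λ j → f i j))
    where
      f : ∀ i j → (eqF i j ∨ not (ltM (t i) nothing ∧ eqM (t i) (t j))) ≡ true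
      f i j with eqF i j in eq
      ... | true = refl
      ... | false with t i in ti
      ... | nothing = refl
      ... | just v with eqM (just v) (t j) in e2
      ... | false = refl
      ... | true = ⊥-elim (t≢f (P.trans (P.sym (P.subst (λ z → eqF i z ≡ true) (inj i j v ti (P.sym (eqM-true e2))) (eqF-refl i))) eq))

  predL-just : ∀ {n} (t : SuccMap n) (i : Fin n) (js : List (Fin n)) {j : Fin n} → predL t i js ≡ just j → t j ≡ just i
  predL-just t i (k ∷ js) e with eqM (t k) (just i) in eq
  ... | true with e
  ... | refl = eqM-true eq
  predL-just t i (k ∷ js) e | false = predL-just t i js e

  predL-nothing : ∀ {n} (t : SuccMap n) (i : Fin n) (js : List (Fin n)) → predL t i js ≡ nothing → ∀ j → j ∈ js → t j ≢ just i
  predL-nothing t i (k ∷ js) e j m tj with eqM (t k) (just i) in eq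
  predL-nothing t i (k ∷ js) () j m tj | true
  predL-nothing t i (k ∷ js) e j (here refl) tj | false = t≢f (P.trans (P.sym (P.subst (λ z → eqM z (just i) ≡ true) (P.sym tj) (eqM-refl (just i)))) eq)
  predL-nothing t i (k ∷ js) e j (there m) tj | false = predL-nothing t i js e j m tj

  predL-intro : ∀ {n} (t : SuccMap n) (i : Fin n) (js : List (Fin n)) → (∀ j → j ∈ js → t j ≢ just i) → predL t i js ≡ nothing
  predL-intro t i [] h = refl
  predL-intro t i (k ∷ js) h with eqM (t k) (just i) in eq
  ... | true = ⊥-elim (h k (here refl) (eqM-true eq))
  ... | false = predL-intro t i js (λ j m → h j (there m))

  p-just : ∀ {n} (t : SuccMap n) {i j : Fin n} → p t i ≡ just j → t j ≡ just i
  p-just {n} t {i} = predL-just t i (allFin n)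

  p-nothing : ∀ {n} (t : SuccMap n) {i : Fin n} → p t i ≡ nothing → ∀ j → t j ≢ just i
  p-nothing {n} t {i} e j = predL-nothing t i (allFin n) e j (∈-allFin j)

  p-intro-nothing : ∀ {n} (t : SuccMap n) {i : Fin n} → (∀ j → t j ≢ just i) → p t i ≡ nothing
  p-intro-nothing {n} t {i} h = predL-intro t i (allFin n) (λ j _ → h j)

  p-intro-just : ∀ {n} (t : SuccMap n) → Injective t → {i j : Fin n} → t j ≡ just i → p t i ≡ just j
  p-intro-just t inj {i} {j} tj with p t i in eq
  ... | nothing = ⊥-elim (p-nothing t eq j tj)
  ... | just k = P.cong just (inj k j i (p-just t eq) tj)

  step : ∀ {n} → SuccMap n → Maybe (Fin n) → Maybe (Fin n)
  step t nothing = nothing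
  step t (just j) = t j

  iterM : ∀ {n} → SuccMap n → ℕ → Maybe (Fin n) → Maybe (Fin n)
  iterM t k nothing = nothing
  iterM t k (just j) = iter t k j

  iter-suc : ∀ {n} (t : SuccMap n) (m : ℕ) (i : Fin n) → iter t (suc m) i ≡ step t (iter t m i)
  iter-suc t m i with iter t m i
  ... | nothing = refl
  ... | just j = refl

  iter-add : ∀ {n} (t : SuccMap n) (m k : ℕ) (i : Fin n) → iter t (m + k) i ≡ iterM t k (iter t m i)
  iter-add t m zero i with iter t m i in eq
  ... | nothing = P.trans (P.cong (λ z → iter t z i) (NP.+-identityʳ m)) eq
  ... | just j = P.trans (P.cong (λ z → iter t z i) (NP.+-identityʳ m)) eq
  iter-add t m (suc k) i = P.trans (P.cong (λ z → iter t z i) (NP.+-suc m k))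
     (P.trans (iter-suc t (m + k) i) (P.trans (P.cong (step t) (iter-add t m k i)) (lem (iter t m i))))
    where
      lem : ∀ v → step t (iterM t k v) ≡ iterM t (suc k) v
      lem nothing = refl
      lem (just j) = P.sym (iter-suc t k j)

  iter-sucˡ : ∀ {n} (t : SuccMap n) (m : ℕ) (i : Fin n) → iter t (suc m) i ≡ iterM t m (t i)
  iter-sucˡ t m i = iter-add t 1 m i

  iter-nothing : ∀ {n} (t : SuccMap n) (m k : ℕ) (i : Fin n) → iter t m i ≡ nothing → iter t (m + k) i ≡ nothing
  iter-nothing t m k i e = P.trans (iter-add t m k i) (P.cong (iterM t k) e)

  iter-nothing-≤ : ∀ {n} (t : SuccMap n) (m a : ℕ) (i : Fin n) → m ≤ a → iter t m i ≡ nothing → iter t a i ≡ nothing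
  iter-nothing-≤ t m a i le e = P.subst (λ z → iter t z i ≡ nothing) (NP.m+[n∸m]≡n le) (iter-nothing t m (a ∸ m) i e)

  iter-defined-below : ∀ {n} (t : SuccMap n) (c a : ℕ) (i : Fin n) → c ≤ a → ∀ {v} → iter t a i ≡ just v → ∃ λ w → iter t c i ≡ just w
  iter-defined-below t c a i le {v} e with iter t c i in eq
  ... | just w = w , refl
  ... | nothing with P.trans (P.sym (iter-nothing-≤ t c a i le eq)) e
  ... | ()

  -- Pigeonhole on the first n + 1 iterates: a repeated vertex lets the walk be shortened.
  iter-bounded : ∀ {n} (t : SuccMap n) (a : ℕ) (i v : Fin n) → iter t a i ≡ just v → ∃ λ a' → a' < n × iter t a' i ≡ just v
  iter-bounded {n} t a i v e = go a (<-wellFounded a) e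
    where
      go : ∀ a → Acc _<_ a → iter t a i ≡ just v → ∃ λ a' → a' < n × iter t a' i ≡ just v
      go a (acc rs) e with a ℕ.<? n
      ... | yes a<n = a , a<n , e
      ... | no a≮n = res
        where
          n≤a : n ≤ a
          n≤a = NP.≮⇒≥ a≮n
          g : Fin (suc n) → Fin n
          g c = fromMaybe i (iter t (toℕ c) i)
          pg = FP.pigeonhole (NP.n<1+n n) g
          c1 = proj₁ pg
          c2 = proj₁ (proj₂ pg)
          c1<c2 : toℕ c1 < toℕ c2
          c1<c2 = proj₁ (proj₂ (proj₂ pg))
          geq : g c1 ≡ g c2
          geq = proj₂ (proj₂ (proj₂ pg))
          c2≤a : toℕ c2 ≤ a
          c2≤a = NP.≤-trans (ℕ.s≤s⁻¹ (FP.toℕ<n c2)) n≤a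
          j1 = iter-defined-below t (toℕ c1) a i (NP.≤-trans (NP.<⇒≤ c1<c2) c2≤a) e
          j2 = iter-defined-below t (toℕ c2) a i c2≤a e
          same : iter t (toℕ c1) i ≡ iter t (toℕ c2) i
          same = P.trans (proj₂ j1) (P.trans (P.cong just (P.trans (P.cong (fromMaybe i) (P.sym (proj₂ j1))) (P.trans geq (P.cong (fromMaybe i) (proj₂ j2)))))
              (P.sym (proj₂ j2)))
          d = a ∸ toℕ c2
          a' = toℕ c1 + d
          eq-a : toℕ c2 + d ≡ a
          eq-a = NP.m+[n∸m]≡n c2≤a
          e' : iter t a' i ≡ just v
          e' = P.trans (iter-add t (toℕ c1) d i) (P.trans (P.cong (iterM t d) same) (P.trans (P.sym (iter-add t (toℕ c2) d i))
              (P.trans (P.cong (λ z → iter t z i) eq-a) e)))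
          a'<a : a' < a
          a'<a = P.subst (a' <_) eq-a (NP.+-monoˡ-< d c1<c2)
          res = go a' (rs a'<a) e'

  OnCycle : ∀ {n} → SuccMap n → Fin n → Set
  OnCycle t i = ∃ λ m → iter t (suc m) i ≡ just i

  MinOfOrbit : ∀ {n} → SuccMap n → Fin n → Set
  MinOfOrbit t i = ∀ m → ltM (iter t m i) (just i) ≡ false

  ∈-steps : ∀ {n m} → m < n → suc m ∈ steps n
  ∈-steps h = ∈-map⁺ suc (∈-upTo⁺ h)

  steps-∈ : ∀ {n k} → k ∈ steps n → ∃ λ m → k ≡ suc m × m < n
  steps-∈ mem with ∈-map⁻ suc mem
  ... | m , mm , refl = m , refl , ∈-upTo⁻ mm

  onCycle⇒ : ∀ {n} (t : SuccMap n) (i : Fin n) → onCycle t i ≡ true → OnCycle t i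
  onCycle⇒ {n} t i e with anyL-∈ (steps n) e
  ... | k , mem , h with steps-∈ mem
  ... | m , refl , _ = m , eqM-true h

  onCycle⇐ : ∀ {n} (t : SuccMap n) (i : Fin n) → OnCycle t i → onCycle t i ≡ true
  onCycle⇐ {n} t i (m , e) with t i in ti
  ... | nothing = ⊥-elim (nj (P.trans (P.sym (P.trans (iter-sucˡ t m i) (P.cong (iterM t m) ti))) e))
    where nj : ∀ {A : Set} {x : A} → nothing ≢ just x
          nj ()
  ... | just j with iter-bounded t m j i (P.trans (P.sym (P.cong (iterM t m) ti)) (P.trans (P.sym (iter-sucˡ t m i)) e))
  ... | a , a<n , ea = anyL-intro {P = λ m → eqM (iter t m i) (just i)} (∈-steps a<n)
          (P.subst (λ z → eqM z (just i) ≡ true) (P.sym (P.trans (iter-sucˡ t a i) (P.trans (P.cong (iterM t a) ti) ea))) (eqM-refl (just i)))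

  minOfOrbit⇐ : ∀ {n} (t : SuccMap n) (i : Fin n) → MinOfOrbit t i → minOfOrbit t i ≡ true
  minOfOrbit⇐ {n} t i h = allL-intro (steps n) (λ m _ → P.cong not (h m))

  minOfOrbit⇒ : ∀ {n} (t : SuccMap n) (i : Fin n) → minOfOrbit t i ≡ true → MinOfOrbit t i
  minOfOrbit⇒ {n} t i e m with iter t m i in eq
  ... | nothing = refl
  ... | just v with iter-bounded t m i v eq
  ... | zero , _ , e0 with e0
  ... | refl = ltF-irrefl i
  minOfOrbit⇒ {n} t i e m | just v | suc a , a<n , ea =
    P.trans (P.cong (λ z → ltM z (just i)) (P.sym ea)) (not-true (allL-∈ {P = λ m → not (ltM (iter t m i) (just i))} e (∈-steps (NP.<-trans (NP.n<1+n a) a<n))))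

open SuccessorMaps

module Extensionality where

  open P using (refl)

  allL-cong : ∀ {A : Set} {P Q : A → Bool} (xs : List A) → (∀ x → P x ≡ Q x) → allL P xs ≡ allL Q xs
  allL-cong [] h = refl
  allL-cong (x ∷ xs) h = P.cong₂ _∧_ (h x) (allL-cong xs h)

  anyL-cong : ∀ {A : Set} {P Q : A → Bool} (xs : List A) → (∀ x → P x ≡ Q x) → anyL P xs ≡ anyL Q xs
  anyL-cong [] h = refl
  anyL-cong (x ∷ xs) h = P.cong₂ _∨_ (h x) (anyL-cong xs h)

  filter-cong : ∀ {A : Set} {P Q : A → Bool} (xs : List A) → (∀ x → P x ≡ Q x) →
                filter (λ x → P x B.≟ true) xs ≡ filter (λ x → Q x B.≟ true) xs
  filter-cong [] h = refl
  filter-cong {P = P} {Q} (x ∷ xs) h with P x | Q x | h x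
  ... | true | .true | refl = P.cong (x ∷_) (filter-cong xs h)
  ... | false | .false | refl = filter-cong xs h

  module Cong {n : ℕ} (t u : SuccMap n) (e : ∀ i → t i ≡ u i) where
    predL-cong : ∀ i js → predL t i js ≡ predL u i js
    predL-cong i [] = refl
    predL-cong i (j ∷ js) rewrite e j | predL-cong i js = refl

    p-cong : ∀ i → p t i ≡ p u i
    p-cong i = predL-cong i (allFin n)

    iter-cong : ∀ m i → iter t m i ≡ iter u m i
    iter-cong m i = lem m
      where
        lem : ∀ m → iter t m i ≡ iter u m i
        lem zero = refl
        lem (suc m) rewrite iter-suc t m i | iter-suc u m i | lem m with iter u m i
        ... | nothing = refl
        ... | just j = e j

    isLaguerre-cong : isLaguerre t ≡ isLaguerre u
    isLaguerre-cong = allL-cong (allFin n) (λ i → allL-cong (allFin n) (lemma i))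
      where
        lemma : ∀ i j → (eqF i j ∨ not (ltM (t i) nothing ∧ eqM (t i) (t j))) ≡ (eqF i j ∨ not (ltM (u i) nothing ∧ eqM (u i) (u j)))
        lemma i j rewrite e i | e j = refl

    peak-cong : ∀ i → isPeak t i ≡ isPeak u i
    peak-cong i rewrite e i | p-cong i = refl

    valley-cong : ∀ i → isValley t i ≡ isValley u i
    valley-cong i rewrite e i | p-cong i = refl

    isAlternating-cong : isAlternating t ≡ isAlternating u
    isAlternating-cong = allL-cong (allFin n) lemma
      where
        lemma : ∀ i → not (isDAsc t i ∨ isDDesc t i ∨ isFixed t i) ≡ not (isDAsc u i ∨ isDDesc u i ∨ isFixed u i)
        lemma i rewrite e i | p-cong i = refl

    paths-cong : paths t ≡ paths u
    paths-cong = count-cong (allFin n) (λ i → P.cong (λ z → eqM z nothing) (p-cong i))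

    cyc-cong : cyc t ≡ cyc u
    cyc-cong = count-cong (allFin n) (λ i → P.cong₂ _∧_
        (anyL-cong (steps n) (λ m → P.cong (λ z → eqM z (just i)) (iter-cong m i)))
        (allL-cong (steps n) (λ m → P.cong (λ z → not (ltM z (just i))) (iter-cong m i))))

    ulev-cong : ∀ j → ulev t j ≡ ulev u j
    ulev-cong j rewrite e j = P.cong (λ z → if_then_else_ (ltM (just j) (u j)) z 0)
       (count-cong (allFin n) (λ i → P.cong (λ z → ltF i j ∧ ltM (just j) z) (e i)))

    lcross-cong : ∀ k → lcross t k ≡ lcross u k
    lcross-cong k = sumℕ-cong (allFin n) (λ i → sumℕ-cong (allFin n) (λ j →
       count-cong (allExt n) (λ l → P.cong₂ (λ z w → ltF i j ∧ ltF j k ∧ ltM (just k) l ∧ eqM z (just k) ∧ eqM w l) (p-cong i) (p-cong j))))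

    lnest-cong : ∀ k → lnest t k ≡ lnest u k
    lnest-cong k = sumℕ-cong (allFin n) (λ i → sumℕ-cong (allFin n) (λ j →
       count-cong (allExt n) (λ l → P.cong₂ (λ z w → ltF i j ∧ ltF j k ∧ ltM (just k) l ∧ eqM w (just k) ∧ eqM z l) (p-cong i) (p-cong j))))

    weight-cong : ∀ {c ℓ : Level} (R : CommutativeSemiring c ℓ) a b λ' → weight R a b λ' t ≡ weight R a b λ' u
    weight-cong R a b λ' rewrite cyc-cong
       | filter-cong {P = isValley t} (allFin n) valley-cong
       | filter-cong {P = isPeak t} (allFin n) peak-cong
       | LP.map-cong (λ i → P.cong a (ulev-cong i)) (filter (λ i → isValley u i B.≟ true) (allFin n))
       | LP.map-cong (λ i → P.cong₂ b (lcross-cong i) (lnest-cong i)) (filter (λ i → isPeak u i B.≟ true) (allFin n))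
       = refl

open Extensionality

module Restriction where

  open import Data.Nat using (_+_)
  open P using (refl)

  -- The innermost count over l ∈ [n] ∪ {∞} in lcross and lnest has the single candidate l = p(j) (resp. p(i)).
  count-indicator : ∀ {N} (a b d : Bool) (K : Maybe (Fin N)) (v : Maybe (Fin N)) →
     count (λ l → a ∧ b ∧ ltM K l ∧ d ∧ eqM v l) (allExt N) ≡ χ (a ∧ b ∧ ltM K v ∧ d)
  count-indicator {N} false b d K v = count-false (allExt N) (λ _ → refl)
  count-indicator {N} true false d K v = count-false (allExt N) (λ _ → refl)
  count-indicator {N} true true false K v = P.trans (count-false (allExt N) (λ l → BP.∧-zeroʳ (ltM K l))) (P.cong χ (P.sym (BP.∧-zeroʳ (ltM K v))))
  count-indicator {N} true true true K nothing = P.trans (count-allExt (λ l → ltM K l ∧ eqM nothing l))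
     (P.trans (P.cong₂ _+_ refl (count-false (allFin N) (λ j → BP.∧-zeroʳ (ltM K (just j))))) (NP.+-identityʳ _))
  count-indicator {N} true true true K (just w) = P.trans (count-allExt (λ l → ltM K l ∧ eqM (just w) l))
     (P.trans (P.cong (χ (ltM K nothing ∧ false) +_) (count-unique (λ j → ltM K (just j) ∧ eqF w j) w
          (λ j ne → P.trans (P.cong (ltM K (just j) ∧_) (eqF-false (λ e → ne (P.sym e)))) (BP.∧-zeroʳ _))))
       (P.trans (P.cong (λ z → χ z + χ (ltM K (just w) ∧ eqF w w)) (BP.∧-zeroʳ (ltM K nothing)))
          (P.cong (λ z → χ (ltM K (just w) ∧ z)) (eqF-refl w))))

  lcrossTerm : ∀ {N} → SuccMap N → Fin N → Fin N → Fin N → ℕ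
  lcrossTerm t k i j = χ (ltF i j ∧ ltF j k ∧ ltM (just k) (p t j) ∧ eqM (p t i) (just k))

  lnestTerm : ∀ {N} → SuccMap N → Fin N → Fin N → Fin N → ℕ
  lnestTerm t k i j = χ (ltF i j ∧ ltF j k ∧ ltM (just k) (p t i) ∧ eqM (p t j) (just k))

  lcross≡sumℕ : ∀ {N} (t : SuccMap N) (k : Fin N) → lcross t k ≡ sumℕ (allFin N) (λ i → sumℕ (allFin N) (λ j → lcrossTerm t k i j))
  lcross≡sumℕ {N} t k = sumℕ-cong (allFin N) (λ i → sumℕ-cong (allFin N) (λ j →
     count-indicator (ltF i j) (ltF j k) (eqM (p t i) (just k)) (just k) (p t j)))

  lnest≡sumℕ : ∀ {N} (t : SuccMap N) (k : Fin N) → lnest t k ≡ sumℕ (allFin N) (λ i → sumℕ (allFin N) (λ j → lnestTerm t k i j))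
  lnest≡sumℕ {N} t k = sumℕ-cong (allFin N) (λ i → sumℕ-cong (allFin N) (λ j →
     count-indicator (ltF i j) (ltF j k) (eqM (p t j) (just k)) (just k) (p t i)))

  sumℕ-last : ∀ {n} (f : Fin (suc n) → ℕ) → sumℕ (allFin (suc n)) f ≡ sumℕ (allFin n) (f ∘ ι) + f (ℓ n)
  sumℕ-last {n} f = Sumℕ.fold-last n f

  record Compat {n : ℕ} (t : SuccMap (suc n)) (u : SuccMap n) : Set where
    field
      cs : ∀ i → Agree (t (ι i)) (u i)
      cp : ∀ i → Agree (p t (ι i)) (p u i)

  module Invariance {n : ℕ} (t : SuccMap (suc n)) (u : SuccMap n) (C : Compat t u) where
    open Compat C

    peak-inv : ∀ i → isPeak t (ι i) ≡ isPeak u i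
    peak-inv i = P.cong₂ _∧_ (Agree-ltˡ (cp i) i) (Agree-ltˡ (cs i) i)

    valley-inv : ∀ i → isValley t (ι i) ≡ isValley u i
    valley-inv i = P.cong₂ _∧_ (Agree-ltʳ (cp i) i) (Agree-ltʳ (cs i) i)

    dasc-inv : ∀ i → isDAsc t (ι i) ≡ isDAsc u i
    dasc-inv i = P.cong₂ _∧_ (Agree-ltˡ (cp i) i) (Agree-ltʳ (cs i) i)

    ddesc-inv : ∀ i → isDDesc t (ι i) ≡ isDDesc u i
    ddesc-inv i = P.cong₂ _∧_ (Agree-ltʳ (cp i) i) (Agree-ltˡ (cs i) i)

    fixed-inv : ∀ i → isFixed t (ι i) ≡ isFixed u i
    fixed-inv i = P.cong₂ _∧_ (Agree-eq (cp i) i) (Agree-eq (cs i) i)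

    alternatingAt : ∀ {N} → SuccMap N → Fin N → Bool
    alternatingAt t i = not (isDAsc t i ∨ isDDesc t i ∨ isFixed t i)

    isAlternating-inv : isAlternating t ≡ isAlternating u ∧ alternatingAt t (ℓ n)
    isAlternating-inv = P.trans (allL-last (alternatingAt t)) (P.cong (_∧ alternatingAt t (ℓ n))
       (allL-cong (allFin n) (λ i → P.cong not (P.cong₂ _∨_ (dasc-inv i) (P.cong₂ _∨_ (ddesc-inv i) (fixed-inv i))))))

    ulev-inv : ∀ j → ulev t (ι j) ≡ ulev u j
    ulev-inv j rewrite Agree-ltʳ (cs j) j with ltM (just j) (u j)
    ... | false = refl
    ... | true = P.trans (count-last (λ i → ltF i (ι j) ∧ ltM (just (ι j)) (t i)))
        (P.trans (P.cong₂ _+_ (count-cong (allFin n) (λ i → P.cong₂ _∧_ (ltF-ι i j) (Agree-ltʳ (cs i) j)))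
                             (P.cong (λ z → χ (z ∧ ltM (just (ι j)) (t (ℓ n)))) (ltF-ℓ (ι j))))
           (NP.+-identityʳ _))

    open P.≡-Reasoning

    lcross-inv-inner : ∀ k i → sumℕ (allFin (suc n)) (λ j → lcrossTerm t (ι k) (ι i) j) ≡ sumℕ (allFin n) (λ j → lcrossTerm u k i j)
    lcross-inv-inner k i = begin
        sumℕ (allFin (suc n)) (λ j → lcrossTerm t (ι k) (ι i) j)
      ≡⟨ sumℕ-last (λ j → lcrossTerm t (ι k) (ι i) j) ⟩
        sumℕ (allFin n) (λ j → lcrossTerm t (ι k) (ι i) (ι j)) + lcrossTerm t (ι k) (ι i) (ℓ n)
      ≡⟨ P.cong₂ _+_ (sumℕ-cong (allFin n) (λ j → P.cong χ (P.cong₂ _∧_ (ltF-ι i j)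
          (P.cong₂ _∧_ (ltF-ι j k) (P.cong₂ _∧_ (Agree-ltʳ (cp j) k) (Agree-eq (cp i) k))))))
                     (P.trans (P.cong (λ z → χ (ltF (ι i) (ℓ n) ∧ z ∧ ltM (just (ι k)) (p t (ℓ n)) ∧ eqM (p t (ι i)) (just (ι k)))) (ltF-ℓ (ι k)))
                              (P.cong χ (BP.∧-zeroʳ (ltF (ι i) (ℓ n))))) ⟩
        sumℕ (allFin n) (λ j → lcrossTerm u k i j) + 0
      ≡⟨ NP.+-identityʳ _ ⟩
        sumℕ (allFin n) (λ j → lcrossTerm u k i j)
      ∎

    lcross-inv : ∀ k → lcross t (ι k) ≡ lcross u k
    lcross-inv k = begin
        lcross t (ι k)
      ≡⟨ lcross≡sumℕ t (ι k) ⟩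
        sumℕ (allFin (suc n)) (λ i → sumℕ (allFin (suc n)) (λ j → lcrossTerm t (ι k) i j))
      ≡⟨ sumℕ-last (λ i → sumℕ (allFin (suc n)) (λ j → lcrossTerm t (ι k) i j)) ⟩
        sumℕ (allFin n) (λ i → sumℕ (allFin (suc n)) (λ j → lcrossTerm t (ι k) (ι i) j)) + sumℕ (allFin (suc n)) (λ j → lcrossTerm t (ι k) (ℓ n) j)
      ≡⟨ P.cong₂ _+_ (sumℕ-cong (allFin n) (lcross-inv-inner k)) (sumℕ-0 (allFin (suc n))
          (λ j → P.cong (λ z → χ (z ∧ ltF j (ι k) ∧ ltM (just (ι k)) (p t j) ∧ eqM (p t (ℓ n)) (just (ι k)))) (ltF-ℓ j))) ⟩
        sumℕ (allFin n) (λ i → sumℕ (allFin n) (λ j → lcrossTerm u k i j)) + 0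
      ≡⟨ NP.+-identityʳ _ ⟩
        sumℕ (allFin n) (λ i → sumℕ (allFin n) (λ j → lcrossTerm u k i j))
      ≡⟨ P.sym (lcross≡sumℕ u k) ⟩
        lcross u k
      ∎

    lnest-inv-inner : ∀ k i → sumℕ (allFin (suc n)) (λ j → lnestTerm t (ι k) (ι i) j) ≡ sumℕ (allFin n) (λ j → lnestTerm u k i j)
    lnest-inv-inner k i = begin
        sumℕ (allFin (suc n)) (λ j → lnestTerm t (ι k) (ι i) j)
      ≡⟨ sumℕ-last (λ j → lnestTerm t (ι k) (ι i) j) ⟩
        sumℕ (allFin n) (λ j → lnestTerm t (ι k) (ι i) (ι j)) + lnestTerm t (ι k) (ι i) (ℓ n)
      ≡⟨ P.cong₂ _+_ (sumℕ-cong (allFin n) (λ j → P.cong χ (P.cong₂ _∧_ (ltF-ι i j)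
          (P.cong₂ _∧_ (ltF-ι j k) (P.cong₂ _∧_ (Agree-ltʳ (cp i) k) (Agree-eq (cp j) k))))))
                     (P.trans (P.cong (λ z → χ (ltF (ι i) (ℓ n) ∧ z ∧ ltM (just (ι k)) (p t (ι i)) ∧ eqM (p t (ℓ n)) (just (ι k)))) (ltF-ℓ (ι k)))
                              (P.cong χ (BP.∧-zeroʳ (ltF (ι i) (ℓ n))))) ⟩
        sumℕ (allFin n) (λ j → lnestTerm u k i j) + 0
      ≡⟨ NP.+-identityʳ _ ⟩
        sumℕ (allFin n) (λ j → lnestTerm u k i j)
      ∎

    lnest-inv : ∀ k → lnest t (ι k) ≡ lnest u k
    lnest-inv k = begin
        lnest t (ι k)
      ≡⟨ lnest≡sumℕ t (ι k) ⟩
        sumℕ (allFin (suc n)) (λ i → sumℕ (allFin (suc n)) (λ j → lnestTerm t (ι k) i j))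
      ≡⟨ sumℕ-last (λ i → sumℕ (allFin (suc n)) (λ j → lnestTerm t (ι k) i j)) ⟩
        sumℕ (allFin n) (λ i → sumℕ (allFin (suc n)) (λ j → lnestTerm t (ι k) (ι i) j)) + sumℕ (allFin (suc n)) (λ j → lnestTerm t (ι k) (ℓ n) j)
      ≡⟨ P.cong₂ _+_ (sumℕ-cong (allFin n) (lnest-inv-inner k)) (sumℕ-0 (allFin (suc n))
          (λ j → P.cong (λ z → χ (z ∧ ltF j (ι k) ∧ ltM (just (ι k)) (p t (ℓ n)) ∧ eqM (p t j) (just (ι k)))) (ltF-ℓ j))) ⟩
        sumℕ (allFin n) (λ i → sumℕ (allFin n) (λ j → lnestTerm u k i j)) + 0
      ≡⟨ NP.+-identityʳ _ ⟩
        sumℕ (allFin n) (λ i → sumℕ (allFin n) (λ j → lnestTerm u k i j))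
      ≡⟨ P.sym (lnest≡sumℕ u k) ⟩
        lnest u k
      ∎

open Restriction

module LastVertex where

  open import Data.Nat using (_+_)
  open P using (refl)

  just-inj : ∀ {A : Set} {x y : A} → just x ≡ just y → x ≡ y
  just-inj refl = refl

  nothing≢just : ∀ {A : Set} {x : A} → nothing ≢ just x
  nothing≢just ()

  lift-just : ∀ {n} {v : Maybe (Fin n)} {w : Fin n} → lift v ≡ just (ι w) → v ≡ just w
  lift-just {v = just v'} e = P.cong just (ι-inj (just-inj e))

  lift-ℓ : ∀ {n} {v : Maybe (Fin n)} → lift v ≢ just (ℓ n)
  lift-ℓ {v = just v'} e = ι≢ℓ v' (just-inj e)

  lift-inj-just : ∀ {n} {v : Maybe (Fin n)} {w : Fin (suc n)} → lift v ≡ just w → ∃ λ w' → w ≡ ι w' × v ≡ just w'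
  lift-inj-just {v = just v'} refl = v' , refl , refl

  eqM-lift-nothing : ∀ {n} (v : Maybe (Fin n)) → eqM (lift v) nothing ≡ eqM v nothing
  eqM-lift-nothing nothing = refl
  eqM-lift-nothing (just x) = refl

  unlift-just : ∀ {n} {w : Maybe (Fin (suc n))} {v : Fin n} → unlift w ≡ just v → w ≡ just (ι v)
  unlift-just {w = just j} {v} e with lastView j
  ... | old i = P.cong (just ∘ ι) (just-inj (P.trans (P.sym (caseLast-ι just nothing i)) e))
  ... | new = ⊥-elim (nothing≢just (P.trans (P.sym (caseLast-ℓ just nothing)) e))

  lift-unlift : ∀ {n} (w : Maybe (Fin (suc n))) → w ≢ just (ℓ n) → lift (unlift w) ≡ w
  lift-unlift nothing h = refl
  lift-unlift (just j) h with lastView j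
  ... | old i = P.cong lift (caseLast-ι just nothing i)
  ... | new = ⊥-elim (h refl)

  addIsolated : ∀ {n} → SuccMap n → SuccMap (suc n)
  addIsolated u = caseLast (lift ∘ u) nothing

  module AddIsolated {n : ℕ} (u : SuccMap n) (inj : Injective u) where
    addIsolated-ι : ∀ i → addIsolated u (ι i) ≡ lift (u i)
    addIsolated-ι i = caseLast-ι (lift ∘ u) nothing i

    addIsolated-ℓ : addIsolated u (ℓ n) ≡ nothing
    addIsolated-ℓ = caseLast-ℓ (lift ∘ u) nothing

    addIsolated-inj : Injective (addIsolated u)
    addIsolated-inj i j v ei ej = go (lastView i) (lastView j) ei ej
      where
        go : ∀ {i j} → LastView i → LastView j → addIsolated u i ≡ just v → addIsolated u j ≡ just v → i ≡ j
        go (old i) (old j) ei ej with lift-inj-just (P.trans (P.sym (addIsolated-ι i)) ei)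
        ... | w , refl , ui = P.cong ι (inj i j w ui (lift-just {v = u j} (P.trans (P.sym (addIsolated-ι j)) ej)))
        go (old i) new ei ej = ⊥-elim (nothing≢just (P.trans (P.sym addIsolated-ℓ) ej))
        go new (old j) ei ej = ⊥-elim (nothing≢just (P.trans (P.sym addIsolated-ℓ) ei))
        go new new ei ej = refl

    p-addIsolated-ι : ∀ i → p (addIsolated u) (ι i) ≡ lift (p u i)
    p-addIsolated-ι i with p u i in eq
    ... | just j = p-intro-just (addIsolated u) addIsolated-inj (P.trans (addIsolated-ι j) (P.cong lift (p-just u eq)))
    ... | nothing = p-intro-nothing (addIsolated u) (λ j → go j (lastView j))
      where
        go : ∀ j → LastView j → addIsolated u j ≢ just (ι i)
        go _ (old j) e = p-nothing u eq j (lift-just (P.trans (P.sym (addIsolated-ι j)) e))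
        go _ new e = nothing≢just (P.trans (P.sym addIsolated-ℓ) e)

    p-addIsolated-ℓ : p (addIsolated u) (ℓ n) ≡ nothing
    p-addIsolated-ℓ = p-intro-nothing (addIsolated u) (λ j → go j (lastView j))
      where
        go : ∀ j → LastView j → addIsolated u j ≢ just (ℓ n)
        go _ (old j) e = lift-ℓ {v = u j} (P.trans (P.sym (addIsolated-ι j)) e)
        go _ new e = nothing≢just (P.trans (P.sym addIsolated-ℓ) e)

    compat : Compat (addIsolated u) u
    compat = record { cs = λ i → P.subst (λ z → Agree z (u i)) (P.sym (addIsolated-ι i)) (Agree-lift (u i))
                    ; cp = λ i → P.subst (λ z → Agree z (p u i)) (P.sym (p-addIsolated-ι i)) (Agree-lift (p u i)) }

    open Invariance (addIsolated u) u compat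

    alternating-ℓ : alternatingAt (addIsolated u) (ℓ n) ≡ true
    alternating-ℓ rewrite addIsolated-ℓ | p-addIsolated-ℓ = refl

    valley-ℓ : isValley (addIsolated u) (ℓ n) ≡ true
    valley-ℓ rewrite addIsolated-ℓ | p-addIsolated-ℓ = refl

    peak-ℓ : isPeak (addIsolated u) (ℓ n) ≡ false
    peak-ℓ rewrite addIsolated-ℓ | p-addIsolated-ℓ = refl

    paths-addIsolated : paths (addIsolated u) ≡ paths u + 1
    paths-addIsolated = P.trans (count-last (λ i → eqM (p (addIsolated u) i) nothing))
       (P.cong₂ _+_ (count-cong (allFin n) (λ i → P.trans (P.cong (λ z → eqM z nothing) (p-addIsolated-ι i)) (eqM-lift-nothing (p u i))))
                    (P.cong (λ z → χ (eqM z nothing)) p-addIsolated-ℓ))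

    #ends : ℕ
    #ends = count (λ i → eqM (u i) nothing) (allFin n)

    ulev-ℓ : ulev (addIsolated u) (ℓ n) ≡ #ends
    ulev-ℓ rewrite addIsolated-ℓ = P.trans (count-last (λ i → ltF i (ℓ n) ∧ ltM (just (ℓ n)) (addIsolated u i)))
        (P.trans (P.cong₂ _+_ (count-cong (allFin n) (λ i → P.trans (P.cong₂ _∧_ (ltF-ιℓ i) (P.cong (ltM (just (ℓ n))) (addIsolated-ι i))) (lem (u i))))
                              (P.cong (λ z → χ (z ∧ ltM (just (ℓ n)) (addIsolated u (ℓ n)))) (ltF-irrefl (ℓ n))))
                 (NP.+-identityʳ _))
      where
        lem : ∀ v → (true ∧ ltM (just (ℓ n)) (lift v)) ≡ eqM v nothing
        lem nothing = refl
        lem (just w) = ltF-ℓ (ι w)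

  addPeak : ∀ {n} → SuccMap n → Fin n → Fin n → SuccMap (suc n)
  addPeak {n} u x y = caseLast (λ i → if eqF i x then just (ℓ n) else lift (u i)) (just (ι y))

  dropLast : ∀ {n} → SuccMap (suc n) → SuccMap n
  dropLast t i = unlift (t (ι i))

  if-eqF : ∀ {n} {A : Set} (i x : Fin n) (a b : A) → i ≢ x → (if eqF i x then a else b) ≡ b
  if-eqF i x a b ne rewrite eqF-false ne = refl

  if-eqF-refl : ∀ {n} {A : Set} (x : Fin n) (a b : A) → (if eqF x x then a else b) ≡ a
  if-eqF-refl x a b rewrite eqF-refl x = refl

  count-split : ∀ {n} (Q : Fin n → Bool) (y : Fin n) → count Q (allFin n) ≡ count (λ i → not (eqF i y) ∧ Q i) (allFin n) + χ (Q y)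
  count-split {n} Q y = P.trans (count≡sumℕ Q (allFin n)) (P.trans (Sumℕ.fold-cong (allFin n) lem)
     (P.trans (Sumℕ.fold-∙ (allFin n) _ _) (P.cong₂ _+_ (P.sym (count≡sumℕ _ (allFin n)))
       (P.trans (P.sym (count≡sumℕ _ (allFin n))) (P.trans (count-unique (λ i → eqF i y ∧ Q i) y (λ j ne → P.cong (_∧ Q j) (eqF-false ne)))
           (P.cong (λ z → χ (z ∧ Q y)) (eqF-refl y)))))))
    where
      lem : ∀ i → χ (Q i) ≡ χ (not (eqF i y) ∧ Q i) + χ (eqF i y ∧ Q i)
      lem i with eqF i y | Q i
      ... | true | true = refl
      ... | true | false = refl
      ... | false | true = refl
      ... | false | false = refl

  sumℕ-unique : ∀ {n} (f : Fin n → ℕ) (w : Fin n) → (∀ j → j ≢ w → f j ≡ 0) → sumℕ (allFin n) f ≡ f w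
  sumℕ-unique {suc n} f Fin.zero h = P.trans (Sumℕ.fold-first n f) (P.trans (P.cong (f Fin.zero +_) (sumℕ-0 (allFin n) (λ j → h (Fin.suc j) (λ ()))))
      (NP.+-identityʳ _))
  sumℕ-unique {suc n} f (Fin.suc w) h = P.trans (Sumℕ.fold-first n f) (P.trans (P.cong (_+ sumℕ (allFin n) (f ∘ Fin.suc)) (h Fin.zero (λ ())))
       (sumℕ-unique (f ∘ Fin.suc) w (λ j ne → h (Fin.suc j) (λ e → ne (FP.suc-injective e)))))

  ltM-ℓ-lift : ∀ {n} (v : Maybe (Fin n)) → ltM (just (ℓ n)) (lift v) ≡ eqM v nothing
  ltM-ℓ-lift nothing = refl
  ltM-ℓ-lift (just w) = ltF-ℓ (ι w)

  module AddPeak {n : ℕ} (u : SuccMap n) (x y : Fin n) (inj : Injective u) (ux : u x ≡ nothing) (py : p u y ≡ nothing) where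
    t : SuccMap (suc n)
    t = addPeak u x y

    tι : ∀ i → t (ι i) ≡ (if eqF i x then just (ℓ n) else lift (u i))
    tι i = caseLast-ι _ (just (ι y)) i

    tℓ : t (ℓ n) ≡ just (ι y)
    tℓ = caseLast-ℓ (λ i → if eqF i x then just (ℓ n) else lift (u i)) (just (ι y))

    tx : t (ι x) ≡ just (ℓ n)
    tx = P.trans (tι x) (if-eqF-refl x _ _)

    tne : ∀ i → i ≢ x → t (ι i) ≡ lift (u i)
    tne i ne = P.trans (tι i) (if-eqF i x _ _ ne)

    tι-just : ∀ i w → t (ι i) ≡ just (ι w) → u i ≡ just w
    tι-just i w e with i Fin.≟ x
    ... | yes refl = ⊥-elim (ι≢ℓ w (just-inj (P.trans (P.sym e) tx)))
    ... | no ne = lift-just {v = u i} (P.trans (P.sym (tne i ne)) e)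

    tι-ℓ : ∀ i → t (ι i) ≡ just (ℓ n) → i ≡ x
    tι-ℓ i e with i Fin.≟ x
    ... | yes eq = eq
    ... | no ne = ⊥-elim (lift-ℓ {v = u i} (P.trans (P.sym (tne i ne)) e))

    t-inj : Injective t
    t-inj i j v ei ej = go (lastView i) (lastView j) (lastView v) ei ej
      where
        go : ∀ {i j v} → LastView i → LastView j → LastView v → t i ≡ just v → t j ≡ just v → i ≡ j
        go (old i) (old j) (old w) ei ej = P.cong ι (inj i j w (tι-just i w ei) (tι-just j w ej))
        go (old i) (old j) new ei ej = P.cong ι (P.trans (tι-ℓ i ei) (P.sym (tι-ℓ j ej)))
        go (old i) new (old w) ei ej with just-inj (P.trans (P.sym tℓ) ej)
        ... | e = ⊥-elim (p-nothing u py i (P.trans (tι-just i w ei) (P.cong just (ι-inj (P.sym e)))))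
        go (old i) new new ei ej = ⊥-elim (ι≢ℓ y (just-inj (P.trans (P.sym tℓ) ej)))
        go new (old j) (old w) ei ej with just-inj (P.trans (P.sym tℓ) ei)
        ... | e = ⊥-elim (p-nothing u py j (P.trans (tι-just j w ej) (P.cong just (ι-inj (P.sym e)))))
        go new (old j) new ei ej = ⊥-elim (ι≢ℓ y (just-inj (P.trans (P.sym tℓ) ei)))
        go new new _ ei ej = refl

    ptne : ∀ i → i ≢ y → p t (ι i) ≡ lift (p u i)
    ptne i ne = lem (p u i) refl
      where
        lem : ∀ v → p u i ≡ v → p t (ι i) ≡ lift v
        lem (just j) eq = p-intro-just t t-inj (P.trans (tne j jx) (P.cong lift (p-just u eq)))
          where
            jx : j ≢ x
            jx refl = nothing≢just (P.trans (P.sym ux) (p-just u eq))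
        lem nothing eq = p-intro-nothing t (λ j → go j (lastView j))
          where
            go : ∀ j → LastView j → t j ≢ just (ι i)
            go _ (old j) e = p-nothing u eq j (tι-just j i e)
            go _ new e = ne (P.sym (ι-inj (just-inj (P.trans (P.sym tℓ) e))))

    pty : p t (ι y) ≡ just (ℓ n)
    pty = p-intro-just t t-inj tℓ

    ptℓ : p t (ℓ n) ≡ just (ι x)
    ptℓ = p-intro-just t t-inj tx

    compat : Compat t u
    compat = record { cs = cs ; cp = cp }
      where
        cs : ∀ i → Agree (t (ι i)) (u i)
        cs i with i Fin.≟ x
        ... | yes refl = P.subst₂ Agree (P.sym tx) (P.sym ux) last∞
        ... | no ne = P.subst (λ z → Agree z (u i)) (P.sym (tne i ne)) (Agree-lift (u i))
        cp : ∀ i → Agree (p t (ι i)) (p u i)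
        cp i with i Fin.≟ y
        ... | yes refl = P.subst₂ Agree (P.sym pty) (P.sym py) last∞
        ... | no ne = P.subst (λ z → Agree z (p u i)) (P.sym (ptne i ne)) (Agree-lift (p u i))

    open Invariance t u compat

    alternating-ℓ : alternatingAt t (ℓ n) ≡ true
    alternating-ℓ rewrite tℓ | ptℓ | ltF-ιℓ x | ltF-ℓ (ι y) | ltF-ℓ (ι x) | eqF-ιℓ x = refl

    peak-ℓ : isPeak t (ℓ n) ≡ true
    peak-ℓ rewrite tℓ | ptℓ | ltF-ιℓ x | ltF-ιℓ y = refl

    valley-ℓ : isValley t (ℓ n) ≡ false
    valley-ℓ rewrite tℓ | ptℓ | ltF-ℓ (ι x) = refl

    paths-addPeak : paths t + 1 ≡ paths u
    paths-addPeak = P.trans (P.cong (_+ 1) (P.trans (count-last (λ i → eqM (p t i) nothing))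
                  (P.trans (P.cong₂ _+_ (count-cong (allFin n) lem) (P.cong (λ z → χ (eqM z nothing)) ptℓ)) (NP.+-identityʳ _))))
              (P.trans (P.cong (count (λ i → not (eqF i y) ∧ eqM (p u i) nothing) (allFin n) +_) (P.cong χ (P.sym (P.cong (λ z → eqM z nothing) py))))
                       (P.sym (count-split (λ i → eqM (p u i) nothing) y)))
      where
        lem : ∀ i → eqM (p t (ι i)) nothing ≡ (not (eqF i y) ∧ eqM (p u i) nothing)
        lem i with eqF i y in e
        ... | true rewrite eqF-true e | pty = refl
        ... | false = P.trans (P.cong (λ z → eqM z nothing) (ptne i (λ q → t≢f (P.trans (P.sym (eqF-intro q)) e)))) (eqM-lift-nothing (p u i))

    p≡ℓ⇒ιy : ∀ i → eqM (p t i) (just (ℓ n)) ≡ true → i ≡ ι y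
    p≡ℓ⇒ιy i e = P.sym (just-inj (P.trans (P.sym tℓ) (p-just t (eqM-true e))))

    ne-of-lt : ∀ {a b : Fin n} → ltF a b ≡ true → b ≢ a
    ne-of-lt {a} h refl = t≢f (P.trans (P.sym h) (ltF-irrefl a))

    ne-of-gt : ∀ {a b : Fin n} → ltF a b ≡ true → a ≢ b
    ne-of-gt {a} h refl = t≢f (P.trans (P.sym h) (ltF-irrefl a))

    startsAbove-term : ∀ j (b : Bool) → (b ≡ true → j ≢ y) → χ (b ∧ true ∧ ltM (just (ℓ n)) (p t (ι j)) ∧ true) ≡ χ (b ∧ eqM (p u j) nothing)
    startsAbove-term j false h = refl
    startsAbove-term j true h = P.cong χ (P.trans (BP.∧-identityʳ _) (P.trans (P.cong (ltM (just (ℓ n))) (ptne j (h refl))) (ltM-ℓ-lift (p u j))))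

    ∧-false⁴ : ∀ a b c → (a ∧ b ∧ c ∧ false) ≡ false
    ∧-false⁴ a b c = P.trans (P.cong (λ z → a ∧ b ∧ z) (BP.∧-zeroʳ c)) (P.trans (P.cong (a ∧_) (BP.∧-zeroʳ b)) (BP.∧-zeroʳ a))

    open P.≡-Reasoning

    lcross-ℓ : lcross t (ℓ n) ≡ count (λ j → ltF y j ∧ eqM (p u j) nothing) (allFin n)
    lcross-ℓ = begin
        lcross t (ℓ n)
      ≡⟨ lcross≡sumℕ t (ℓ n) ⟩
        sumℕ (allFin (suc n)) (λ i → sumℕ (allFin (suc n)) (λ j → lcrossTerm t (ℓ n) i j))
      ≡⟨ sumℕ-unique (λ i → sumℕ (allFin (suc n)) (λ j → lcrossTerm t (ℓ n) i j)) (ι y) (λ i ne → sumℕ-0 (allFin (suc n)) (λ j → P.cong χ (P.trans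
              (P.cong (λ z → ltF i j ∧ ltF j (ℓ n) ∧ ltM (just (ℓ n)) (p t j) ∧ z) (≢true (λ e → ne (p≡ℓ⇒ιy i e)))) (∧-false⁴ (ltF i j) (ltF j (ℓ n))
                  (ltM (just (ℓ n)) (p t j)))))) ⟩
        sumℕ (allFin (suc n)) (λ j → lcrossTerm t (ℓ n) (ι y) j)
      ≡⟨ sumℕ-last (λ j → lcrossTerm t (ℓ n) (ι y) j) ⟩
        sumℕ (allFin n) (λ j → lcrossTerm t (ℓ n) (ι y) (ι j)) + lcrossTerm t (ℓ n) (ι y) (ℓ n)
      ≡⟨ P.cong₂ _+_ (sumℕ-cong (allFin n) ∑∑-addPeak) last0 ⟩
        sumℕ (allFin n) (λ j → χ (ltF y j ∧ eqM (p u j) nothing)) + 0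
      ≡⟨ NP.+-identityʳ _ ⟩
        sumℕ (allFin n) (λ j → χ (ltF y j ∧ eqM (p u j) nothing))
      ≡⟨ P.sym (count≡sumℕ _ (allFin n)) ⟩
        count (λ j → ltF y j ∧ eqM (p u j) nothing) (allFin n)
      ∎
      where
        ∑∑-addPeak : ∀ j → lcrossTerm t (ℓ n) (ι y) (ι j) ≡ χ (ltF y j ∧ eqM (p u j) nothing)
        ∑∑-addPeak j rewrite pty | eqF-refl (ℓ n) | ltF-ι y j | ltF-ιℓ j = startsAbove-term j (ltF y j) ne-of-lt
        last0 : lcrossTerm t (ℓ n) (ι y) (ℓ n) ≡ 0
        last0 rewrite ltF-irrefl (ℓ n) = P.cong χ (BP.∧-zeroʳ (ltF (ι y) (ℓ n)))

    lnest-ℓ : lnest t (ℓ n) ≡ count (λ i → ltF i y ∧ eqM (p u i) nothing) (allFin n)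
    lnest-ℓ = begin
        lnest t (ℓ n)
      ≡⟨ lnest≡sumℕ t (ℓ n) ⟩
        sumℕ (allFin (suc n)) (λ i → sumℕ (allFin (suc n)) (λ j → lnestTerm t (ℓ n) i j))
      ≡⟨ sumℕ-cong (allFin (suc n)) (λ i → sumℕ-unique (λ j → lnestTerm t (ℓ n) i j) (ι y) (λ j ne → P.cong χ (P.trans
              (P.cong (λ z → ltF i j ∧ ltF j (ℓ n) ∧ ltM (just (ℓ n)) (p t i) ∧ z) (≢true (λ e → ne (p≡ℓ⇒ιy j e)))) (∧-false⁴ (ltF i j) (ltF j (ℓ n))
                  (ltM (just (ℓ n)) (p t i)))))) ⟩
        sumℕ (allFin (suc n)) (λ i → lnestTerm t (ℓ n) i (ι y))
      ≡⟨ sumℕ-last (λ i → lnestTerm t (ℓ n) i (ι y)) ⟩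
        sumℕ (allFin n) (λ i → lnestTerm t (ℓ n) (ι i) (ι y)) + lnestTerm t (ℓ n) (ℓ n) (ι y)
      ≡⟨ P.cong₂ _+_ (sumℕ-cong (allFin n) ∑∑-addPeak) last0 ⟩
        sumℕ (allFin n) (λ i → χ (ltF i y ∧ eqM (p u i) nothing)) + 0
      ≡⟨ NP.+-identityʳ _ ⟩
        sumℕ (allFin n) (λ i → χ (ltF i y ∧ eqM (p u i) nothing))
      ≡⟨ P.sym (count≡sumℕ _ (allFin n)) ⟩
        count (λ i → ltF i y ∧ eqM (p u i) nothing) (allFin n)
      ∎
      where
        ∑∑-addPeak : ∀ i → lnestTerm t (ℓ n) (ι i) (ι y) ≡ χ (ltF i y ∧ eqM (p u i) nothing)
        ∑∑-addPeak i rewrite pty | eqF-refl (ℓ n) | ltF-ι i y | ltF-ιℓ y = startsAbove-term i (ltF i y) ne-of-gt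
        last0 : lnestTerm t (ℓ n) (ℓ n) (ι y) ≡ 0
        last0 rewrite ltF-ℓ (ι y) = refl

  module DropLast {n : ℕ} (t : SuccMap (suc n)) (inj : Injective t) (alt : isAlternating t ≡ true) where
    dropLast-just : ∀ i v → dropLast t i ≡ just v → t (ι i) ≡ just (ι v)
    dropLast-just i v e = unlift-just {w = t (ι i)} e

    dropLast-inj : Injective (dropLast t)
    dropLast-inj i j v ei ej = ι-inj (inj (ι i) (ι j) (ι v) (dropLast-just i v ei) (dropLast-just j v ej))

    just-dropLast : ∀ i v → t (ι i) ≡ just (ι v) → dropLast t i ≡ just v
    just-dropLast i v e = P.trans (P.cong unlift e) (caseLast-ι just nothing v)

    cp : ∀ i → Agree (p t (ι i)) (p (dropLast t) i)
    cp i with p t (ι i) in e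
    ... | nothing = P.subst (Agree nothing) (P.sym (p-intro-nothing (dropLast t) (λ j ej → p-nothing t e (ι j) (dropLast-just j i ej)))) both∞
    ... | just w = go w (lastView w) e
      where
        go : ∀ w → LastView w → p t (ι i) ≡ just w → Agree (just w) (p (dropLast t) i)
        go _ (old j) e = P.subst (Agree (just (ι j))) (P.sym (p-intro-just (dropLast t) dropLast-inj (just-dropLast j i (p-just t e)))) (agree j)
        go _ new e = P.subst (Agree (just (ℓ n))) (P.sym
            (p-intro-nothing (dropLast t) (λ j ej → ι≢ℓ j (inj (ι j) (ℓ n) (ι i) (dropLast-just j i ej) (p-just t e))))) last∞

    compat : Compat t (dropLast t)
    compat = record { cs = λ i → Agree-unlift (t (ι i)) ; cp = cp }

    open Invariance t (dropLast t) compat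

    alternating-ℓ : alternatingAt t (ℓ n) ≡ true
    alternating-ℓ = ∧-true₂ {isAlternating (dropLast t)} (P.trans (P.sym isAlternating-inv) alt)

    dropLast-alternating : isAlternating (dropLast t) ≡ true
    dropLast-alternating = ∧-true₁ (P.trans (P.sym isAlternating-inv) alt)

    module IsolatedLast (tℓ : t (ℓ n) ≡ nothing) where
      ptℓ : p t (ℓ n) ≡ nothing
      ptℓ with p t (ℓ n) in e
      ... | nothing = refl
      ... | just w = go w (lastView w) e
        where
          go : ∀ w → LastView w → p t (ℓ n) ≡ just w → just w ≡ nothing
          go _ (old j) e = ⊥-elim (t≢f (P.trans (P.sym alternating-ℓ) (P.cong not (lem (ltF-ιℓ j)))))
            where
              lem : ltF (ι j) (ℓ n) ≡ true → (isDAsc t (ℓ n) ∨ isDDesc t (ℓ n) ∨ isFixed t (ℓ n)) ≡ true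
              lem h rewrite e | tℓ | h = refl
          go _ new e = ⊥-elim (nothing≢just (P.trans (P.sym tℓ) (p-just t e)))

      addIsolated-dropLast : ∀ j → addIsolated (dropLast t) j ≡ t j
      addIsolated-dropLast j = go j (lastView j)
        where
          go : ∀ j → LastView j → addIsolated (dropLast t) j ≡ t j
          go _ (old i) = P.trans (caseLast-ι _ nothing i) (lift-unlift (t (ι i)) (λ e → p-nothing t ptℓ (ι i) e))
          go _ new = P.trans (caseLast-ℓ {n} (lift ∘ dropLast t) nothing) (P.sym tℓ)

    module PeakLast {w : Fin (suc n)} (tℓ : t (ℓ n) ≡ just w) where
      private
        altℓ' : (isDAsc t (ℓ n) ∨ isDDesc t (ℓ n) ∨ isFixed t (ℓ n)) ≡ false
        altℓ' = P.trans (P.sym (BP.not-involutive _)) (P.cong not alternating-ℓ)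

      yv : ∃ λ y → t (ℓ n) ≡ just (ι y)
      yv = go w (lastView w) tℓ
        where
          go : ∀ w → LastView w → t (ℓ n) ≡ just w → ∃ λ y → t (ℓ n) ≡ just (ι y)
          go _ (old y) e = y , e
          go _ new e = ⊥-elim (t≢f (P.trans (P.sym lem) altℓ'))
            where
              pl : p t (ℓ n) ≡ just (ℓ n)
              pl = p-intro-just t inj e
              lem : (isDAsc t (ℓ n) ∨ isDDesc t (ℓ n) ∨ isFixed t (ℓ n)) ≡ true
              lem rewrite pl | e | eqF-refl (ℓ n) | ltF-irrefl (ℓ n) = refl

      y : Fin n
      y = proj₁ yv
      ty : t (ℓ n) ≡ just (ι y)
      ty = proj₂ yv

      xv : ∃ λ x → t (ι x) ≡ just (ℓ n)
      xv with p t (ℓ n) in e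
      ... | nothing = ⊥-elim (t≢f (P.trans (P.sym lem) altℓ'))
        where
          lem : (isDAsc t (ℓ n) ∨ isDDesc t (ℓ n) ∨ isFixed t (ℓ n)) ≡ true
          lem rewrite e | ty | ltF-ιℓ y = refl
      ... | just w' = go w' (lastView w') e
        where
          go : ∀ w' → LastView w' → p t (ℓ n) ≡ just w' → ∃ λ x → t (ι x) ≡ just (ℓ n)
          go _ (old x) e = x , p-just t e
          go _ new e = ⊥-elim (ι≢ℓ y (just-inj (P.trans (P.sym ty) (p-just t e))))

      x : Fin n
      x = proj₁ xv
      tx : t (ι x) ≡ just (ℓ n)
      tx = proj₂ xv

      rx : dropLast t x ≡ nothing
      rx = P.trans (P.cong unlift tx) (caseLast-ℓ just nothing)

      py : p (dropLast t) y ≡ nothing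
      py = p-intro-nothing (dropLast t) (λ j ej → ι≢ℓ j (inj (ι j) (ℓ n) (ι y) (dropLast-just j y ej) ty))

      addPeak-dropLast : ∀ j → addPeak (dropLast t) x y j ≡ t j
      addPeak-dropLast j = go j (lastView j)
        where
          go : ∀ j → LastView j → addPeak (dropLast t) x y j ≡ t j
          go _ (old i) = P.trans (caseLast-ι _ (just (ι y)) i) (lem (eqF i x) refl)
            where
              lem : ∀ b → eqF i x ≡ b → (if b then just (ℓ n) else lift (dropLast t i)) ≡ t (ι i)
              lem true e rewrite eqF-true e = P.sym tx
              lem false e = lift-unlift (t (ι i)) (λ q → t≢f (P.trans
                  (P.sym (P.subst (λ z → eqF i z ≡ true) (ι-inj (inj (ι i) (ι x) (ℓ n) q tx)) (eqF-refl i))) e))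
          go _ new = P.trans (caseLast-ℓ {n} (λ i → if eqF i x then just (ℓ n) else lift (dropLast t i)) (just (ι y))) (P.sym ty)

open LastVertex

module Cycles where

  open import Data.Nat using (_+_; _*_)
  open P using (refl)

  isCycleMin : ∀ {n} → SuccMap n → Fin n → Bool
  isCycleMin t i = onCycle t i ∧ minOfOrbit t i

  isCycleMin-lift : ∀ {n} (t : SuccMap (suc n)) (u : SuccMap n) (i : Fin n) →
              (∀ m → iter t m (ι i) ≡ lift (iter u m i)) → isCycleMin t (ι i) ≡ isCycleMin u i
  isCycleMin-lift t u i h = P.cong₂ _∧_
     (bool-ext (λ e → onCycle⇐ u i (c1 (onCycle⇒ t (ι i) e))) (λ e → onCycle⇐ t (ι i) (c2 (onCycle⇒ u i e))))
     (bool-ext (λ e → minOfOrbit⇐ u i (m1 (minOfOrbit⇒ t (ι i) e))) (λ e → minOfOrbit⇐ t (ι i) (m2 (minOfOrbit⇒ u i e))))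
    where
      c1 : OnCycle t (ι i) → OnCycle u i
      c1 (m , e) = m , lift-just {v = iter u (suc m) i} (P.trans (P.sym (h (suc m))) e)
      c2 : OnCycle u i → OnCycle t (ι i)
      c2 (m , e) = m , P.trans (h (suc m)) (P.cong lift e)
      m1 : MinOfOrbit t (ι i) → MinOfOrbit u i
      m1 g m = P.trans (P.sym (Agree-ltˡ (Agree-lift (iter u m i)) i)) (P.trans (P.cong (λ z → ltM z (just (ι i))) (P.sym (h m))) (g m))
      m2 : MinOfOrbit u i → MinOfOrbit t (ι i)
      m2 g m = P.trans (P.cong (λ z → ltM z (just (ι i))) (h m)) (P.trans (Agree-ltˡ (Agree-lift (iter u m i)) i) (g m))

  step-lift : ∀ {n} (u : SuccMap n) (v : Maybe (Fin n)) → step (addIsolated u) (lift v) ≡ lift (step u v)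
  step-lift u nothing = refl
  step-lift u (just j) = caseLast-ι (lift ∘ u) nothing j

  iter-addIsolated : ∀ {n} (u : SuccMap n) (m : ℕ) (i : Fin n) → iter (addIsolated u) m (ι i) ≡ lift (iter u m i)
  iter-addIsolated u zero i = refl
  iter-addIsolated u (suc m) i = P.trans (iter-suc (addIsolated u) m (ι i)) (P.trans (P.cong (step (addIsolated u)) (iter-addIsolated u m i))
      (P.trans (step-lift u (iter u m i)) (P.cong lift (P.sym (iter-suc u m i)))))

  cyc-addIsolated : ∀ {n} (u : SuccMap n) → cyc (addIsolated u) ≡ cyc u
  cyc-addIsolated {n} u = P.trans (count-last (isCycleMin (addIsolated u))) (P.trans
      (P.cong₂ _+_ (count-cong (allFin n) (λ i → isCycleMin-lift (addIsolated u) u i (λ m → iter-addIsolated u m i))) lastF) (NP.+-identityʳ _))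
    where
      noc : onCycle (addIsolated u) (ℓ n) ≡ false
      noc = ≢true (λ e → go (onCycle⇒ (addIsolated u) (ℓ n) e))
        where
          go : OnCycle (addIsolated u) (ℓ n) → ⊥
          go (m , e) = nothing≢just (P.trans (P.sym (P.cong (iterM (addIsolated u) m) (caseLast-ℓ (lift ∘ u) nothing))) (P.trans
              (P.sym (iter-sucˡ (addIsolated u) m (ℓ n))) e))
      lastF : χ (isCycleMin (addIsolated u) (ℓ n)) ≡ 0
      lastF rewrite noc = refl

  module Orbit {n : ℕ} (u : SuccMap n) (inj : Injective u) where
    iter-inj : ∀ a {i j v} → iter u a i ≡ just v → iter u a j ≡ just v → i ≡ j
    iter-inj zero refl refl = refl
    iter-inj (suc a) {i} {j} {v} ei ej with iter u a i in eqi | iter u a j in eqj | iter-suc u a i | iter-suc u a j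
    ... | just w | just w' | si | sj = iter-inj a eqi (P.trans eqj (P.cong just (inj w' w v (P.trans (P.sym sj) ej) (P.trans (P.sym si) ei))))
    ... | nothing | _ | si | sj = ⊥-elim (nothing≢just (P.trans (P.sym si) ei))
    ... | just w | nothing | si | sj = ⊥-elim (nothing≢just (P.trans (P.sym sj) ej))

    start-notReentered : ∀ {y} → p u y ≡ nothing → ∀ d i → iter u (suc d) i ≢ just y
    start-notReentered {y} py d i e with iter u d i in eq | iter-suc u d i
    ... | nothing | s = nothing≢just (P.trans (P.sym s) e)
    ... | just z | s = p-nothing u py z (P.trans (P.sym s) e)

    end-time : ∀ {i x a b} → u x ≡ nothing → iter u a i ≡ just x → iter u b i ≡ just x → a ≡ b
    end-time {i} {x} {a} {b} ux ea eb with NP.<-cmp a b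
    ... | tri≈ _ e _ = e
    ... | tri< a<b _ _ = ⊥-elim (nothing≢just (P.trans (P.sym (iter-nothing-≤ u (suc a) b i a<b
                       (P.trans (iter-suc u a i) (P.trans (P.cong (step u) ea) ux)))) eb))
    ... | tri> _ _ b<a = ⊥-elim (nothing≢just (P.trans (P.sym (iter-nothing-≤ u (suc b) a i b<a
                       (P.trans (iter-suc u b i) (P.trans (P.cong (step u) eb) ux)))) ea))

    start-reaches : ∀ {y i v a b} → p u y ≡ nothing → iter u a i ≡ just v → iter u b y ≡ just v →
           ∃ λ c → c + a ≡ b × iter u c y ≡ just i
    start-reaches {y} {i} {v} {a} {b} py ea eb with a ℕ.≤? b
    ... | yes a≤b = c , NP.m∸n+n≡m a≤b , P.trans (proj₂ z) (P.cong just
        (iter-inj a (P.trans (P.sym (iterM-j (proj₂ z))) (P.trans (P.sym (iter-add u c a y)) (P.trans (P.cong (λ q → iter u q y) (NP.m∸n+n≡m a≤b)) eb))) ea))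
      where
        c = b ∸ a
        z : ∃ λ w → iter u c y ≡ just w
        z = iter-defined-below u c b y (NP.m∸n≤m b a) eb
        iterM-j : ∀ {w} → iter u c y ≡ just w → iterM u a (iter u c y) ≡ iter u a w
        iterM-j e rewrite e = refl
    ... | no a≰b = ⊥-elim (start-notReentered py d' i (P.trans (P.cong (λ q → iter u q i) dd) (P.trans (proj₂ z) (P.cong just yz))))
      where
        d = a ∸ b
        b<a : b < a
        b<a = NP.≰⇒> a≰b
        d' = ℕ.pred d
        dd : suc d' ≡ d
        dd = NP.suc-pred d ⦃ ℕ.>-nonZero (NP.m<n⇒0<n∸m b<a) ⦄
        z : ∃ λ w → iter u d i ≡ just w
        z = iter-defined-below u d a i (NP.m∸n≤m a b) ea
        yz : proj₁ z ≡ y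
        yz = iter-inj b (P.trans (P.sym (iterM-j (proj₂ z))) (P.trans (P.sym (iter-add u d b i))
            (P.trans (P.cong (λ q → iter u q i) (NP.m∸n+n≡m (NP.<⇒≤ b<a))) ea))) eb
          where
            iterM-j : ∀ {w} → iter u d i ≡ just w → iterM u b (iter u d i) ≡ iter u b w
            iterM-j e rewrite e = refl

    reaches : Fin n → Fin n → Bool
    reaches i v = anyL (λ a → eqM (iter u a i) (just v)) (upTo n)

    reaches-true : ∀ {i v} → reaches i v ≡ true → ∃ λ a → iter u a i ≡ just v
    reaches-true {i} {v} e with anyL-∈ (upTo n) e
    ... | a , _ , h = a , eqM-true h

    reaches-intro : ∀ {i v a} → iter u a i ≡ just v → reaches i v ≡ true
    reaches-intro {i} {v} {a} e with iter-bounded u a i v e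
    ... | a' , a'<n , e' = anyL-intro {P = λ a → eqM (iter u a i) (just v)} (∈-upTo⁺ a'<n) (P.subst (λ z → eqM z (just v) ≡ true) (P.sym e')
        (eqM-refl (just v)))

    last-defined : ∀ N {i} → iter u N i ≡ nothing → ∃ λ c → ∃ λ v → iter u c i ≡ just v × u v ≡ nothing
    last-defined zero ()
    last-defined (suc N) {i} e = go (iter u N i) refl (P.trans (P.sym (iter-suc u N i)) e)
      where
        go : ∀ w → iter u N i ≡ w → step u w ≡ nothing → ∃ λ c → ∃ λ v → iter u c i ≡ just v × u v ≡ nothing
        go nothing eq _ = last-defined N eq
        go (just v) eq s = N , v , eq , s

    start-term : ∀ {y} → p u y ≡ nothing → iter u n y ≡ nothing
    start-term {y} py with iter u n y in eq
    ... | nothing = refl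
    ... | just v with iter-bounded u n y v eq
    ... | a' , a'<n , e' with start-reaches py e' eq
    ... | zero , ca , _ = ⊥-elim (NP.<-irrefl ca a'<n)
    ... | suc c , _ , ec = ⊥-elim (start-notReentered py c y ec)

    end-exists : ∀ {y} → p u y ≡ nothing → ∃ λ x → u x ≡ nothing × reaches y x ≡ true
    end-exists py with last-defined n (start-term py)
    ... | c , v , ec , uv = v , uv , reaches-intro {a = c} ec

    end-unique : ∀ {y x1 x2} → u x1 ≡ nothing → u x2 ≡ nothing → reaches y x1 ≡ true → reaches y x2 ≡ true → x1 ≡ x2
    end-unique {y} {x1} {x2} u1 u2 h1 h2 with reaches-true h1 | reaches-true h2
    ... | b1 , e1 | b2 , e2 with NP.<-cmp b1 b2
    ... | tri≈ _ refl _ = just-inj (P.trans (P.sym e1) e2)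
    ... | tri< b1<b2 _ _ = ⊥-elim (nothing≢just (P.trans (P.sym (iter-nothing-≤ u (suc b1) b2 y b1<b2
                       (P.trans (iter-suc u b1 y) (P.trans (P.cong (step u) e1) u1)))) e2))
    ... | tri> _ _ b2<b1 = ⊥-elim (nothing≢just (P.trans (P.sym (iter-nothing-≤ u (suc b2) b1 y b2<b1
                       (P.trans (iter-suc u b2 y) (P.trans (P.cong (step u) e2) u2)))) e1))

  isLeast : ∀ {n} → (Fin n → Bool) → Fin n → Bool
  isLeast {n} H i = allL (λ j → not (H j ∧ ltF j i)) (allFin n)

  least-exists : ∀ {n} (H : Fin n → Bool) (w : Fin n) → H w ≡ true → ∃ λ m → H m ≡ true × isLeast H m ≡ true
  least-exists {n} H w hw = go w (<-wellFounded (toℕ w)) hw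
    where
      go : ∀ w → Acc _<_ (toℕ w) → H w ≡ true → ∃ λ m → H m ≡ true × isLeast H m ≡ true
      go w (acc rs) hw with FP.any? (λ j → (H j ∧ ltF j w) B.≟ true)
      ... | yes (j , hj) = go j (rs (ltF-true (∧-true₂ {H j} hj))) (∧-true₁ hj)
      ... | no none = w , hw , allFin-intro (λ j → P.cong not (≢true (λ e → none (j , e))))

  count-isLeast : ∀ {n} (H : Fin n → Bool) (w : Fin n) → H w ≡ true → count (λ i → H i ∧ isLeast H i) (allFin n) ≡ 1
  count-isLeast {n} H w hw with least-exists H w hw
  ... | m , hm , mm = count-one _ m (∧-intro hm mm) uniq
    where
      notlt : ∀ {a b} → H a ≡ true → isLeast H b ≡ true → ltF a b ≡ false
      notlt {a} {b} ha mb with P.trans (P.sym (BP.not-involutive _)) (P.cong not (allFin-all {P = λ j → not (H j ∧ ltF j b)} mb a))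
      ... | e rewrite ha = e
      uniq : ∀ j → (H j ∧ isLeast H j) ≡ true → j ≡ m
      uniq j e with notlt (∧-true₁ e) mm | notlt hm (∧-true₂ {H j} e)
      ... | f1 | f2 with NP.<-cmp (toℕ j) (toℕ m)
      ... | tri< lt _ _ = ⊥-elim (t≢f (P.trans (P.sym (ltF-intro lt)) f1))
      ... | tri≈ _ eq _ = FP.toℕ-injective eq
      ... | tri> _ _ gt = ⊥-elim (t≢f (P.trans (P.sym (ltF-intro gt)) f2))

open Cycles

module PeakCycles where

  open import Data.Nat using (_+_; _*_)
  open P using (refl)

  module AddPeakCycles {n : ℕ} (u : SuccMap n) (x y : Fin n) (inj : Injective u) (ux : u x ≡ nothing) (py : p u y ≡ nothing) where
    open AddPeak u x y inj ux py
    open Orbit u inj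

    toX : Fin n → Bool
    toX i = reaches i x

    iter-pre : ∀ m i → (∀ c → c < m → iter u c i ≢ just x) → iter t m (ι i) ≡ lift (iter u m i)
    iter-pre zero i h = refl
    iter-pre (suc m) i h = P.trans (iter-suc t m (ι i)) (P.trans (P.cong (step t) (iter-pre m i (λ c c<m → h c (NP.m<n⇒m<1+n c<m))))
         (P.trans (lem (iter u m i) refl) (P.cong lift (P.sym (iter-suc u m i)))))
      where
        lem : ∀ v → iter u m i ≡ v → step t (lift v) ≡ lift (step u v)
        lem nothing _ = refl
        lem (just w) e = tne w (λ wx → h m (NP.n<1+n m) (P.trans e (P.cong just wx)))

    iter-avoidingX : ∀ i → toX i ≡ false → ∀ m → iter t m (ι i) ≡ lift (iter u m i)
    iter-avoidingX i hf m = iter-pre m i (λ c _ e → t≢f (P.trans (P.sym (reaches-intro {a = c} e)) hf))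

    hit-ℓ : ∀ {i a} → iter u a i ≡ just x → iter t (suc a) (ι i) ≡ just (ℓ n)
    hit-ℓ {i} {a} e = P.trans (iter-suc t a (ι i)) (P.trans (P.cong (step t) (P.trans
         (iter-pre a i (λ c c<a ec → NP.<-irrefl (end-time ux ec e) c<a)) (P.cong lift e))) tx)

    hit-y : ∀ {i a} → iter u a i ≡ just x → iter t (suc (suc a)) (ι i) ≡ just (ι y)
    hit-y {i} {a} e = P.trans (iter-suc t (suc a) (ι i)) (P.trans (P.cong (step t) (hit-ℓ {i} {a} e)) tℓ)

    y-path : ∀ {c b} → iter u b y ≡ just x → c ≤ b → iter t c (ι y) ≡ lift (iter u c y)
    y-path {c} {b} eb c≤b = iter-pre c y (λ c' c'<c ec' → NP.<-irrefl (end-time ux ec' eb) (NP.<-≤-trans c'<c c≤b))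

    isCycleMin-ℓ : isCycleMin t (ℓ n) ≡ false
    isCycleMin-ℓ = ≢true (λ e → t≢f (P.trans (P.sym (P.trans (P.cong (λ z → ltM z (just (ℓ n))) tℓ) (ltF-ιℓ y))) (minOfOrbit⇒ t (ℓ n)
        (∧-true₂ {onCycle t (ℓ n)} e) 1)))

    toX-notOnCycle : ∀ i → toX i ≡ true → isCycleMin u i ≡ false
    toX-notOnCycle i hi = ≢true (λ e → go (onCycle⇒ u i (∧-true₁ e)))
      where
        a = proj₁ (reaches-true hi)
        ea = proj₂ (reaches-true hi)
        go : OnCycle u i → ⊥
        go (m , em) = nothing≢just (P.trans (P.sym (iter-nothing-≤ u (suc a) (suc a * suc m) i (NP.m≤m*n (suc a) (suc m))
                        (P.trans (iter-suc u a i) (P.trans (P.cong (step u) ea) ux)))) (per (suc a)))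
          where
            per : ∀ k → iter u (k * suc m) i ≡ just i
            per zero = refl
            per (suc k) = P.trans (iter-add u (suc m) (k * suc m) i) (P.trans (P.cong (iterM u (k * suc m)) em) (per k))

    visitsX? : ∀ m → (∃ λ c → c < m × iter u c y ≡ just x) ⊎ (∀ c → c < m → iter u c y ≢ just x)
    visitsX? zero = inj₂ (λ c ())
    visitsX? (suc m) with visitsX? m
    ... | inj₁ (c , c<m , e) = inj₁ (c , NP.m<n⇒m<1+n c<m , e)
    ... | inj₂ h with eqM (iter u m y) (just x) in eq
    ... | true = inj₁ (m , NP.n<1+n m , eqM-true eq)
    ... | false = inj₂ (λ c c<sm e → lem c (ℕ.s≤s⁻¹ c<sm) e)
      where
        lem : ∀ c → c ≤ m → iter u c y ≢ just x
        lem c c≤m e with NP.m≤n⇒m<n∨m≡n c≤m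
        ... | inj₁ c<m = h c c<m e
        ... | inj₂ refl = t≢f (P.trans (P.sym (P.subst (λ z → eqM z (just x) ≡ true) (P.sym e) (eqM-refl (just x)))) eq)

    noCycleThroughX : reaches y x ≡ false → ∀ i → toX i ≡ true → isCycleMin t (ι i) ≡ false
    noCycleThroughX hf i hi = ≢true (λ e → go (onCycle⇒ t (ι i) (∧-true₁ e)))
      where
        a = proj₁ (reaches-true hi)
        ea = proj₂ (reaches-true hi)
        go : OnCycle t (ι i) → ⊥
        go (m , em) = decide (visitsX? m)
          where
            e1 : iter t (suc a + suc m) (ι i) ≡ iter t (suc m) (ℓ n)
            e1 = P.trans (iter-add t (suc a) (suc m) (ι i)) (P.cong (iterM t (suc m)) (hit-ℓ {i} {a} ea))
            e2 : iter t (suc m + suc a) (ι i) ≡ just (ℓ n)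
            e2 = P.trans (iter-add t (suc m) (suc a) (ι i)) (P.trans (P.cong (iterM t (suc a)) em) (hit-ℓ {i} {a} ea))
            e3 : iter t m (ι y) ≡ just (ℓ n)
            e3 = P.trans (P.sym (P.cong (iterM t m) tℓ)) (P.trans (P.sym (iter-sucˡ t m (ℓ n)))
                (P.trans (P.sym e1) (P.trans (P.cong (λ z → iter t z (ι i)) (NP.+-comm (suc a) (suc m))) e2)))
            decide : _ → ⊥
            decide (inj₁ (c , _ , ec)) = t≢f (P.trans (P.sym (reaches-intro {a = c} ec)) hf)
            decide (inj₂ h) = lift-ℓ {v = iter u m y} (P.trans (P.sym (iter-pre m y h)) e3)

    OrbitShape : Maybe (Fin (suc n)) → Set
    OrbitShape v = (v ≡ nothing) ⊎ (v ≡ just (ℓ n)) ⊎ (∃ λ j → v ≡ just (ι j) × toX j ≡ true)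

    module YReachesX (hy : reaches y x ≡ true) where
      b = proj₁ (reaches-true hy)
      eb = proj₂ (reaches-true hy)

      OrbitShape-step : ∀ v → OrbitShape v → OrbitShape (step t v)
      OrbitShape-step _ (inj₁ refl) = inj₁ refl
      OrbitShape-step _ (inj₂ (inj₁ refl)) = inj₂ (inj₂ (y , tℓ , hy))
      OrbitShape-step _ (inj₂ (inj₂ (j , refl , hj))) with reaches-true hj
      ... | zero , refl = inj₂ (inj₁ tx)
      ... | suc a' , ea' with u j in uj
      ... | nothing = ⊥-elim (nothing≢just (P.trans (P.sym (P.trans (iter-sucˡ u a' j) (P.cong (iterM u a') uj))) ea'))
      ... | just j' = inj₂ (inj₂ (j' , P.trans (tne j jx) (P.cong lift uj) , reaches-intro {a = a'} (P.trans (P.sym (P.cong (iterM u a') uj))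
          (P.trans (P.sym (iter-sucˡ u a' j)) ea'))))
        where
          jx : j ≢ x
          jx refl = nothing≢just (P.trans (P.sym ux) uj)

      OrbitShape-iter : ∀ i → toX i ≡ true → ∀ m → OrbitShape (iter t m (ι i))
      OrbitShape-iter i hi zero = inj₂ (inj₂ (i , refl , hi))
      OrbitShape-iter i hi (suc m) = P.subst OrbitShape (P.sym (iter-suc t m (ι i))) (OrbitShape-step _ (OrbitShape-iter i hi m))

      reach : ∀ i → toX i ≡ true → ∀ j → toX j ≡ true → ∃ λ m → iter t (suc m) (ι i) ≡ just (ι j)
      reach i hi j hj with reaches-true hi | reaches-true hj
      ... | a , ea | aj , eaj with start-reaches {a = aj} {b = b} py eaj eb
      ... | c , ca , ec = suc a + c , P.trans (iter-add t (suc (suc a)) c (ι i)) (P.trans (P.cong (iterM t c) (hit-y {i} {a} ea))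
                            (P.trans (y-path {c} {b} eb (P.subst (c ≤_) ca (NP.m≤m+n c aj))) (P.cong lift ec)))

      isCycleMin-throughX : ∀ i → toX i ≡ true → isCycleMin t (ι i) ≡ isLeast toX i
      isCycleMin-throughX i hi = P.trans (P.cong (_∧ minOfOrbit t (ι i)) (onCycle⇐ t (ι i) (reach i hi i hi)))
         (bool-ext (λ e → allFin-intro {P = λ j → not (toX j ∧ ltF j i)} (λ j → m1 (minOfOrbit⇒ t (ι i) e) j))
                   (λ e → minOfOrbit⇐ t (ι i) (λ m → m2 e (iter t m (ι i)) (OrbitShape-iter i hi m))))
        where
          m1 : MinOfOrbit t (ι i) → ∀ j → not (toX j ∧ ltF j i) ≡ true
          m1 ms j with toX j in hj
          ... | false = refl
          ... | true with reach i hi j hj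
          ... | m , em = P.cong not (P.trans (P.sym (ltF-ι j i)) (P.trans (P.cong (λ z → ltM z (just (ι i))) (P.sym em)) (ms (suc m))))
          m2 : isLeast toX i ≡ true → ∀ v → OrbitShape v → ltM v (just (ι i)) ≡ false
          m2 mb _ (inj₁ refl) = refl
          m2 mb _ (inj₂ (inj₁ refl)) = ltF-ℓ (ι i)
          m2 mb _ (inj₂ (inj₂ (j , refl , hj))) = P.trans (ltF-ι j i) (lem (allFin-all {P = λ j → not (toX j ∧ ltF j i)} mb j))
            where
              lem : not (toX j ∧ ltF j i) ≡ true → ltF j i ≡ false
              lem e rewrite hj = not-true e

    cyc-addPeak : cyc t ≡ cyc u + χ (reaches y x)
    cyc-addPeak = begin
        cyc t
      ≡⟨ count-last (isCycleMin t) ⟩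
        count (isCycleMin t ∘ ι) (allFin n) + χ (isCycleMin t (ℓ n))
      ≡⟨ P.cong₂ _+_ (count-splitBy toX (isCycleMin t ∘ ι) (allFin n)) (P.cong χ isCycleMin-ℓ) ⟩
        (count (λ i → not (toX i) ∧ isCycleMin t (ι i)) (allFin n) + count (λ i → toX i ∧ isCycleMin t (ι i)) (allFin n)) + 0
      ≡⟨ NP.+-identityʳ _ ⟩
        count (λ i → not (toX i) ∧ isCycleMin t (ι i)) (allFin n) + count (λ i → toX i ∧ isCycleMin t (ι i)) (allFin n)
      ≡⟨ P.cong₂ _+_ cycles-avoidingX cycles-throughX ⟩
        count (λ i → not (toX i) ∧ isCycleMin u i) (allFin n) + χ (reaches y x)
      ≡⟨ P.cong (_+ χ (reaches y x)) (P.sym cyc-avoidingX) ⟩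
        cyc u + χ (reaches y x)
      ∎
      where
        open P.≡-Reasoning
        cycles-avoidingX : count (λ i → not (toX i) ∧ isCycleMin t (ι i)) (allFin n) ≡ count (λ i → not (toX i) ∧ isCycleMin u i) (allFin n)
        cycles-avoidingX = count-cong (allFin n) lem
          where
            lem : ∀ i → (not (toX i) ∧ isCycleMin t (ι i)) ≡ (not (toX i) ∧ isCycleMin u i)
            lem i with toX i in hi
            ... | true = refl
            ... | false = isCycleMin-lift t u i (iter-avoidingX i hi)
        cycles-throughX : count (λ i → toX i ∧ isCycleMin t (ι i)) (allFin n) ≡ χ (reaches y x)
        cycles-throughX with reaches y x in hy
        ... | false = count-false (allFin n) lem
          where
            lem : ∀ i → (toX i ∧ isCycleMin t (ι i)) ≡ false
            lem i with toX i in hi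
            ... | false = refl
            ... | true = noCycleThroughX hy i hi
        ... | true = P.trans (count-cong (allFin n) lem) (count-isLeast toX y hy)
          where
            lem : ∀ i → (toX i ∧ isCycleMin t (ι i)) ≡ (toX i ∧ isLeast toX i)
            lem i with toX i in hi
            ... | false = refl
            ... | true = YReachesX.isCycleMin-throughX hy i hi
        cyc-avoidingX : cyc u ≡ count (λ i → not (toX i) ∧ isCycleMin u i) (allFin n)
        cyc-avoidingX = P.trans (count-splitBy toX (isCycleMin u) (allFin n)) (P.trans (P.cong (count (λ i → not (toX i) ∧ isCycleMin u i) (allFin n) +_)
                (count-false (allFin n) lem)) (NP.+-identityʳ _))
          where
            lem : ∀ i → (toX i ∧ isCycleMin u i) ≡ false
            lem i with toX i in hi
            ... | false = refl
            ... | true = toX-notOnCycle i hi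

open PeakCycles

module Weight {c ℓ' : Level} (R : CommutativeSemiring c ℓ') (a : ℕ → CommutativeSemiring.Carrier R)
              (b : ℕ → ℕ → CommutativeSemiring.Carrier R) (λ' : CommutativeSemiring.Carrier R) where
  open CommutativeSemiring R
  open Semi R
  open import Relation.Binary.Reasoning.Setoid setoid

  valleyWeight : ∀ {N} → SuccMap N → Carrier
  valleyWeight {N} t = ∏ (allFin N) (λ i → if isValley t i then a (ulev t i) else 1#)

  peakWeight : ∀ {N} → SuccMap N → Carrier
  peakWeight {N} t = ∏ (allFin N) (λ i → if isPeak t i then b (lcross t i) (lnest t i) else 1#)

  weight≈ : ∀ {N} (t : SuccMap N) → weight R a b λ' t ≈ powR R λ' (cyc t) * (valleyWeight t * peakWeight t)
  weight≈ {N} t = *-cong refl (*-cong (∏-filter (isValley t) (allFin N) (λ i → a (ulev t i))) (∏-filter (isPeak t) (allFin N)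
      (λ i → b (lcross t i) (lnest t i))))

  cong₃ : ∀ {l} {A B C : Set} {D : Set l} (f : A → B → C → D) {x y z u v w} → x ≡ y → z ≡ u → v ≡ w → f x z v ≡ f y u w
  cong₃ f P.refl P.refl P.refl = P.refl

  pow-+ : ∀ m k → powR R λ' (m ℕ.+ k) ≈ powR R λ' m * powR R λ' k
  pow-+ zero k = sym (*-identityˡ _)
  pow-+ (suc m) k = trans (*-cong refl (pow-+ m k)) (sym (*-assoc _ _ _))

  module SplitLast {n : ℕ} (t : SuccMap (suc n)) (u : SuccMap n) (C : Compat t u) where
    open Invariance t u C
    valleyWeight-last : valleyWeight t ≈ valleyWeight u * (if isValley t (ℓ n) then a (ulev t (ℓ n)) else 1#)
    valleyWeight-last = trans (∏-last n _) (*-cong (∏-cong (allFin n)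
        (λ i → reflexive (P.cong₂ (λ z w → if z then a w else 1#) (valley-inv i) (ulev-inv i)))) refl)
    peakWeight-last : peakWeight t ≈ peakWeight u * (if isPeak t (ℓ n) then b (lcross t (ℓ n)) (lnest t (ℓ n)) else 1#)
    peakWeight-last = trans (∏-last n _) (*-cong (∏-cong (allFin n)
        (λ i → reflexive (cong₃ (λ z w v → if z then b w v else 1#) (peak-inv i) (lcross-inv i) (lnest-inv i)))) refl)

  weight-addIsolated : ∀ {n} (u : SuccMap n) (inj : Injective u) → weight R a b λ' (addIsolated u) ≈ a (AddIsolated.#ends u inj) * weight R a b λ' u
  weight-addIsolated {n} u inj = begin
      weight R a b λ' (addIsolated u)
    ≈⟨ weight≈ (addIsolated u) ⟩
      powR R λ' (cyc (addIsolated u)) * (valleyWeight (addIsolated u) * peakWeight (addIsolated u))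
    ≈⟨ *-cong (reflexive (P.cong (powR R λ') (cyc-addIsolated u))) (*-cong valleyWeight-last peakWeight-last) ⟩
      powR R λ' (cyc u) * ((valleyWeight u * (if isValley (addIsolated u) (ℓ n) then a (ulev (addIsolated u) (ℓ n)) else 1#)) * (peakWeight u *
          (if isPeak (addIsolated u) (ℓ n) then b (lcross (addIsolated u) (ℓ n)) (lnest (addIsolated u) (ℓ n)) else 1#)))
    ≡⟨ P.cong₂ (λ z w → powR R λ' (cyc u) * ((valleyWeight u * z) * (peakWeight u * w)))
          (P.trans (P.cong (λ z → if z then a (ulev (addIsolated u) (ℓ n)) else 1#) valley-ℓ) (P.cong a ulev-ℓ))
          (P.cong (λ z → if z then b (lcross (addIsolated u) (ℓ n)) (lnest (addIsolated u) (ℓ n)) else 1#) peak-ℓ) ⟩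
      powR R λ' (cyc u) * ((valleyWeight u * a #ends) * (peakWeight u * 1#))
    ≈⟨ rearr (powR R λ' (cyc u)) (valleyWeight u) (a #ends) (peakWeight u) ⟩
      a #ends * (powR R λ' (cyc u) * (valleyWeight u * peakWeight u))
    ≈⟨ *-cong refl (sym (weight≈ u)) ⟩
      a #ends * weight R a b λ' u
    ∎
    where
      open AddIsolated u inj
      open SplitLast (addIsolated u) u compat
      rearr : ∀ w v x q → w * ((v * x) * (q * 1#)) ≈ x * (w * (v * q))
      rearr w v x q = begin
          w * ((v * x) * (q * 1#))
        ≈⟨ *-cong refl (*-cong (*-comm v x) (*-identityʳ q)) ⟩
          w * ((x * v) * q)
        ≈⟨ *-cong refl (*-assoc x v q) ⟩
          w * (x * (v * q))
        ≈⟨ sym (*-assoc w x _) ⟩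
          (w * x) * (v * q)
        ≈⟨ *-cong (*-comm w x) refl ⟩
          (x * w) * (v * q)
        ≈⟨ *-assoc x w _ ⟩
          x * (w * (v * q))
        ∎

  weight-addPeak : ∀ {n} (u : SuccMap n) (x y : Fin n) (inj : Injective u) (ux : u x ≡ nothing) (py : p u y ≡ nothing) →
       weight R a b λ' (addPeak u x y) ≈ (powR R λ' (χ (Orbit.reaches u inj y x)) * b (count (λ j → ltF y j ∧ eqM (p u j) nothing) (allFin n)) (count
           (λ i → ltF i y ∧ eqM (p u i) nothing) (allFin n))) * weight R a b λ' u
  weight-addPeak {n} u x y inj ux py = begin
      weight R a b λ' t
    ≈⟨ weight≈ t ⟩
      powR R λ' (cyc t) * (valleyWeight t * peakWeight t)
    ≈⟨ *-cong (trans (reflexive (P.cong (powR R λ') (AddPeakCycles.cyc-addPeak u x y inj ux py))) (pow-+ (cyc u) _))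
        (*-cong valleyWeight-last peakWeight-last) ⟩
      (powR R λ' (cyc u) * L) * ((valleyWeight u * (if isValley t (ℓ n) then a (ulev t (ℓ n)) else 1#)) * (peakWeight u *
          (if isPeak t (ℓ n) then b (lcross t (ℓ n)) (lnest t (ℓ n)) else 1#)))
    ≡⟨ P.cong₂ (λ z w → (powR R λ' (cyc u) * L) * ((valleyWeight u * z) * (peakWeight u * w)))
          (P.cong (λ z → if z then a (ulev t (ℓ n)) else 1#) valley-ℓ)
          (P.trans (P.cong (λ z → if z then b (lcross t (ℓ n)) (lnest t (ℓ n)) else 1#) peak-ℓ) (P.cong₂ b lcross-ℓ lnest-ℓ)) ⟩
      (powR R λ' (cyc u) * L) * ((valleyWeight u * 1#) * (peakWeight u * B'))
    ≈⟨ rearr (powR R λ' (cyc u)) L (valleyWeight u) (peakWeight u) B' ⟩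
      (L * B') * (powR R λ' (cyc u) * (valleyWeight u * peakWeight u))
    ≈⟨ *-cong refl (sym (weight≈ u)) ⟩
      (L * B') * weight R a b λ' u
    ∎
    where
      open AddPeak u x y inj ux py
      open SplitLast t u compat
      L = powR R λ' (χ (Orbit.reaches u inj y x))
      B' = b (count (λ j → ltF y j ∧ eqM (p u j) nothing) (allFin n)) (count (λ i → ltF i y ∧ eqM (p u i) nothing) (allFin n))
      rearr : ∀ w l v q z → (w * l) * ((v * 1#) * (q * z)) ≈ (l * z) * (w * (v * q))
      rearr w l v q z = begin
          (w * l) * ((v * 1#) * (q * z))
        ≈⟨ *-cong refl (*-cong (*-identityʳ v) refl) ⟩
          (w * l) * (v * (q * z))
        ≈⟨ *-cong refl (sym (*-assoc v q z)) ⟩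
          (w * l) * ((v * q) * z)
        ≈⟨ *-cong (*-comm w l) (*-comm (v * q) z) ⟩
          (l * w) * (z * (v * q))
        ≈⟨ *-assoc l w _ ⟩
          l * (w * (z * (v * q)))
        ≈⟨ *-cong refl (trans (sym (*-assoc w z _)) (trans (*-cong (*-comm w z) refl) (*-assoc z w _))) ⟩
          l * (z * (w * (v * q)))
        ≈⟨ sym (*-assoc l z _) ⟩
          (l * z) * (w * (v * q))
        ∎


module RankSums where

  ltF-ss : ∀ {n} (i j : Fin n) → ltF (Fin.suc i) (Fin.suc j) ≡ ltF i j
  ltF-ss i j = bool-ext (λ e → ltF-intro (ℕ.s<s⁻¹ (ltF-true e))) (λ e → ltF-intro (ℕ.s<s (ltF-true e)))

  ltF-0s : ∀ {n} (j : Fin n) → ltF Fin.zero (Fin.suc j) ≡ true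
  ltF-0s {n} j = ltF-intro {suc n} {Fin.zero} {Fin.suc j} (ℕ.s≤s ℕ.z≤n)

  ltF-i0 : ∀ {n} (i : Fin (suc n)) → ltF i Fin.zero ≡ false
  ltF-i0 i = ltF-false {i = i} {j = Fin.zero} (λ ())

  module RankSum {c ℓ : Level} (R : CommutativeSemiring c ℓ) where
    open CommutativeSemiring R
    open Semi R
    open import Relation.Binary.Reasoning.Setoid setoid

    ∑< : ℕ → (ℕ → Carrier) → Carrier
    ∑< m h = ∑ (upTo m) h

    ∑-applyUpTo : ∀ (f : ℕ → ℕ) m (h : ℕ → Carrier) → ∑ (applyUpTo f m) h ≡ ∑ (upTo m) (h ∘ f)
    ∑-applyUpTo f zero h = P.refl
    ∑-applyUpTo f (suc m) h = P.cong (h (f 0) +_) (P.trans (∑-applyUpTo (f ∘ suc) m h) (P.sym (∑-applyUpTo suc m (h ∘ f))))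

    ∑<-suc : ∀ m h → ∑< (suc m) h ≡ h 0 + ∑< m (h ∘ suc)
    ∑<-suc m h = P.cong (h 0 +_) (∑-applyUpTo suc m h)

    ∑<-cong : ∀ m {h h'} → (∀ r → r < m → h r ≈ h' r) → ∑< m h ≈ ∑< m h'
    ∑<-cong zero e = refl
    ∑<-cong (suc m) {h} {h'} e = begin
        ∑< (suc m) h ≡⟨ ∑<-suc m h ⟩
        h 0 + ∑< m (h ∘ suc) ≈⟨ +-cong (e 0 (ℕ.s≤s ℕ.z≤n)) (∑<-cong m (λ r r<m → e (suc r) (ℕ.s<s r<m))) ⟩
        h' 0 + ∑< m (h' ∘ suc) ≡⟨ P.sym (∑<-suc m h') ⟩
        ∑< (suc m) h' ∎

    ∑<-last : ∀ m h → ∑< (suc m) h ≈ ∑< m h + h m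
    ∑<-last zero h = trans (+-identityʳ _) (sym (+-identityˡ _))
    ∑<-last (suc m) h = begin
        ∑< (suc (suc m)) h ≡⟨ ∑<-suc (suc m) h ⟩
        h 0 + ∑< (suc m) (h ∘ suc) ≈⟨ +-cong refl (∑<-last m (h ∘ suc)) ⟩
        h 0 + (∑< m (h ∘ suc) + h (suc m)) ≈⟨ sym (+-assoc _ _ _) ⟩
        (h 0 + ∑< m (h ∘ suc)) + h (suc m) ≡⟨ P.cong (_+ h (suc m)) (P.sym (∑<-suc m h)) ⟩
        ∑< (suc m) h + h (suc m) ∎

    ∑<-reverse : ∀ k h → ∑< (suc k) h ≈ ∑< (suc k) (λ r → h (k ∸ r))
    ∑<-reverse zero h = refl
    ∑<-reverse (suc k) h = begin
        ∑< (suc (suc k)) h ≡⟨ ∑<-suc (suc k) h ⟩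
        h 0 + ∑< (suc k) (h ∘ suc) ≈⟨ +-cong refl (∑<-reverse k (h ∘ suc)) ⟩
        h 0 + ∑< (suc k) (λ r → h (suc (k ∸ r))) ≈⟨ +-comm _ _ ⟩
        ∑< (suc k) (λ r → h (suc (k ∸ r))) + h 0 ≈⟨ +-cong (∑<-cong (suc k) (λ r r<sk → reflexive (P.cong h (P.sym (NP.+-∸-assoc 1 (ℕ.s≤s⁻¹ r<sk))))))
            (reflexive (P.cong h (P.sym (NP.n∸n≡0 (suc k))))) ⟩
        ∑< (suc k) (λ r → h (suc k ∸ r)) + h (suc k ∸ suc k) ≈⟨ sym (∑<-last (suc k) (λ r → h (suc k ∸ r))) ⟩
        ∑< (suc (suc k)) (λ r → h (suc k ∸ r)) ∎

    countBelow : ∀ {n} → (Fin n → Bool) → Fin n → ℕ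
    countBelow {n} Sp y = count (λ i → ltF i y ∧ Sp i) (allFin n)

    ∑-byRank : ∀ n (Sp : Fin n → Bool) (g : ℕ → Carrier) → ∑ (allFin n) (λ y → when (Sp y) (g (countBelow Sp y))) ≈ ∑< (count Sp (allFin n)) g
    ∑-byRank zero Sp g = refl
    ∑-byRank (suc n) Sp g = begin
        ∑ (allFin (suc n)) (λ y → when (Sp y) (g (countBelow Sp y)))
      ≡⟨ ∑-first n _ ⟩
        when (Sp Fin.zero) (g (countBelow Sp Fin.zero)) + ∑ (allFin n) (λ y → when (Sp (Fin.suc y)) (g (countBelow Sp (Fin.suc y))))
      ≈⟨ +-cong (reflexive (P.cong (λ z → when (Sp Fin.zero) (g z)) countBelow-zero)) (∑-cong (allFin n)
          (λ y → reflexive (P.cong (λ z → when (Sp (Fin.suc y)) (g z)) (countBelow-suc y)))) ⟩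
        when (Sp Fin.zero) (g 0) + ∑ (allFin n) (λ y → when (Sp (Fin.suc y)) (g (χ (Sp Fin.zero) ℕ.+ countBelow (Sp ∘ Fin.suc) y)))
      ≈⟨ go (Sp Fin.zero) ⟩
        ∑< (χ (Sp Fin.zero) ℕ.+ count (Sp ∘ Fin.suc) (allFin n)) g
      ≡⟨ P.cong (λ z → ∑< z g) (P.sym (count-first Sp)) ⟩
        ∑< (count Sp (allFin (suc n))) g
      ∎
      where
        countBelow-zero : countBelow Sp Fin.zero ≡ 0
        countBelow-zero = count-false (allFin (suc n)) (λ i → P.cong (_∧ Sp i) (ltF-i0 i))
        countBelow-suc : ∀ y → countBelow Sp (Fin.suc y) ≡ χ (Sp Fin.zero) ℕ.+ countBelow (Sp ∘ Fin.suc) y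
        countBelow-suc y = P.trans (count-first (λ i → ltF i (Fin.suc y) ∧ Sp i)) (P.cong₂ ℕ._+_ (P.cong (λ z → χ (z ∧ Sp Fin.zero)) (ltF-0s y))
                 (count-cong (allFin n) (λ i → P.cong (_∧ Sp (Fin.suc i)) (ltF-ss i y))))
        go : ∀ b → when b (g 0) + ∑ (allFin n) (λ y → when (Sp (Fin.suc y)) (g (χ b ℕ.+ countBelow (Sp ∘ Fin.suc) y))) ≈ ∑< (χ b ℕ.+ count (Sp ∘ Fin.suc)
            (allFin n)) g
        go true = trans (+-cong refl (∑-byRank n (Sp ∘ Fin.suc) (g ∘ suc))) (reflexive (P.sym (∑<-suc (count (Sp ∘ Fin.suc) (allFin n)) g)))
        go false = trans (+-identityˡ _) (∑-byRank n (Sp ∘ Fin.suc) g)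

open RankSums

module PeakContribution where

  module Ends {n : ℕ} (u : SuccMap n) (inj : Injective u) where
    isEnd isStart : Fin n → Bool
    isEnd i = eqM (u i) nothing
    isStart i = eqM (p u i) nothing

    sumℕ-successors : ∀ i → sumℕ (allFin n) (λ j → χ (eqM (u i) (just j))) ≡ χ (not (isEnd i))
    sumℕ-successors i with u i
    ... | nothing = sumℕ-0 (allFin n) (λ j → P.refl)
    ... | just w = P.trans (P.sym (count≡sumℕ _ (allFin n))) (P.trans (count-unique (λ j → eqF w j) w (λ j ne → eqF-false (λ e → ne (P.sym e))))
        (P.cong χ (eqF-refl w)))

    sumℕ-predecessors : ∀ j → sumℕ (allFin n) (λ i → χ (eqM (u i) (just j))) ≡ χ (not (isStart j))
    sumℕ-predecessors j with p u j in eq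
    ... | nothing = sumℕ-0 (allFin n) (λ i → P.cong χ (eqM-false (p-nothing u eq i)))
    ... | just i0 = P.trans (P.sym (count≡sumℕ _ (allFin n))) (count-one _ i0 (P.trans (P.cong (λ z → eqM z (just j)) (p-just u eq)) (eqM-refl (just j)))
                       (λ i e → inj i i0 j (eqM-true e) (p-just u eq)))

    -- Double counting of the edges i → j.
    #non-ends≡#non-starts : count (not ∘ isEnd) (allFin n) ≡ count (not ∘ isStart) (allFin n)
    #non-ends≡#non-starts = begin
        count (not ∘ isEnd) (allFin n)                                          ≡⟨ count≡sumℕ _ (allFin n) ⟩
        sumℕ (allFin n) (λ i → χ (not (isEnd i)))                               ≡⟨ sumℕ-cong (allFin n) (λ i → P.sym (sumℕ-successors i)) ⟩
        sumℕ (allFin n) (λ i → sumℕ (allFin n) (λ j → χ (eqM (u i) (just j)))) ≡⟨ Sumℕ.fold-swap (allFin n) (allFin n) _ ⟩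
        sumℕ (allFin n) (λ j → sumℕ (allFin n) (λ i → χ (eqM (u i) (just j)))) ≡⟨ sumℕ-cong (allFin n) sumℕ-predecessors ⟩
        sumℕ (allFin n) (λ j → χ (not (isStart j)))                             ≡⟨ P.sym (count≡sumℕ _ (allFin n)) ⟩
        count (not ∘ isStart) (allFin n)                                        ∎
      where open P.≡-Reasoning

    #ends≡#starts : count isEnd (allFin n) ≡ count isStart (allFin n)
    #ends≡#starts = NP.+-cancelʳ-≡ _ _ _ (begin
        count isEnd (allFin n) ℕ.+ count (not ∘ isEnd) (allFin n)     ≡⟨ count+count-not isEnd (allFin n) ⟩
        count (λ _ → true) (allFin n)                                ≡⟨ P.sym (count+count-not isStart (allFin n)) ⟩
        count isStart (allFin n) ℕ.+ count (not ∘ isStart) (allFin n) ≡⟨ P.cong (count isStart (allFin n) ℕ.+_) (P.sym #non-ends≡#non-starts) ⟩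
        count isStart (allFin n) ℕ.+ count (not ∘ isEnd) (allFin n)   ∎)
      where open P.≡-Reasoning

    startsAbove : Fin n → ℕ
    startsAbove y = count (λ j → ltF y j ∧ isStart j) (allFin n)

    startsBelow : Fin n → ℕ
    startsBelow y = count (λ i → ltF i y ∧ isStart i) (allFin n)

    #starts-split : ∀ y → count isStart (allFin n) ≡ startsBelow y ℕ.+ (χ (isStart y) ℕ.+ startsAbove y)
    #starts-split y = P.trans (count≡sumℕ isStart (allFin n)) (P.trans (Sumℕ.fold-cong (allFin n) lem)
        (P.trans (Sumℕ.fold-∙ (allFin n) _ _) (P.cong₂ ℕ._+_ (P.sym (count≡sumℕ _ (allFin n)))
          (P.trans (Sumℕ.fold-∙ (allFin n) _ _) (P.cong₂ ℕ._+_ (P.trans (P.sym (count≡sumℕ _ (allFin n)))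
               (P.trans (count-unique (λ j → eqF j y ∧ isStart j) y (λ j ne → P.cong (_∧ isStart j) (eqF-false ne))) (P.cong (λ z → χ (z ∧ isStart y))
                   (eqF-refl y))))
             (P.sym (count≡sumℕ _ (allFin n))))))))
      where
        lem : ∀ j → χ (isStart j) ≡ χ (ltF j y ∧ isStart j) ℕ.+ (χ (eqF j y ∧ isStart j) ℕ.+ χ (ltF y j ∧ isStart j))
        lem j with NP.<-cmp (toℕ j) (toℕ y)
        ... | tri< lt _ ngt rewrite ltF-intro lt | eqF-false (λ e → NP.<-irrefl (P.cong toℕ e) lt) | ltF-false ngt = P.sym (NP.+-identityʳ _)
        ... | tri≈ nlt eq ngt rewrite ltF-false nlt | FP.toℕ-injective eq | eqF-refl y | ltF-irrefl y = P.sym (NP.+-identityʳ _)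
        ... | tri> nlt _ gt rewrite ltF-false nlt | eqF-false (λ e → NP.<-irrefl (P.cong toℕ (P.sym e)) gt) | ltF-intro gt = P.refl

    startsAbove≡∸startsBelow : ∀ k → count isStart (allFin n) ≡ suc k → ∀ y → isStart y ≡ true → startsAbove y ≡ k ∸ startsBelow y
    startsAbove≡∸startsBelow k e y sy = P.sym (P.trans (P.cong (_∸ startsBelow y) (P.sym h)) (NP.m+n∸m≡n (startsBelow y) (startsAbove y)))
      where
        h : startsBelow y ℕ.+ startsAbove y ≡ k
        h = NP.suc-injective (P.trans (P.sym (NP.+-suc (startsBelow y) (startsAbove y))) (P.trans
            (P.sym (P.cong (λ z → startsBelow y ℕ.+ (χ z ℕ.+ startsAbove y)) sy)) (P.trans (P.sym (#starts-split y)) e)))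

  module PeakSum {c ℓ : Level} (R : CommutativeSemiring c ℓ) (b : ℕ → ℕ → CommutativeSemiring.Carrier R)
                 (λ' : CommutativeSemiring.Carrier R) {n : ℕ} (u : SuccMap n) (inj : Injective u) (k : ℕ) (pk : count (λ i → eqM (p u i) nothing)
                     (allFin n) ≡ suc k) where
    open CommutativeSemiring R
    open Semi R
    open RankSum R
    open Ends u inj
    open Orbit u inj
    open import Relation.Binary.Reasoning.Setoid setoid

    #ends≡suc : count isEnd (allFin n) ≡ suc k
    #ends≡suc = P.trans #ends≡#starts pk

    pow-split : ∀ e h → when e (powR R λ' (χ h)) ≈ when (e ∧ h) λ' + when (e ∧ not h) 1#
    pow-split true true = trans (*-identityʳ λ') (sym (+-identityʳ λ'))
    pow-split true false = sym (+-identityˡ 1#)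
    pow-split false true = sym (+-identityˡ 0#)
    pow-split false false = sym (+-identityˡ 0#)

    -- Joining the end x to the start y closes a cycle exactly when x ends the path of y.
    ∑-ends : ∀ y → isStart y ≡ true → ∑ (allFin n) (λ x → when (isEnd x) (powR R λ' (χ (reaches y x)))) ≈ λ' + natᴿ k
    ∑-ends y sy = begin
        ∑ (allFin n) (λ x → when (isEnd x) (powR R λ' (χ (reaches y x))))
      ≈⟨ ∑-cong (allFin n) (λ x → pow-split (isEnd x) (reaches y x)) ⟩
        ∑ (allFin n) (λ x → when (isEnd x ∧ reaches y x) λ' + when (isEnd x ∧ not (reaches y x)) 1#)
      ≈⟨ ∑-+ (allFin n) _ _ ⟩
        ∑ (allFin n) (λ x → when (isEnd x ∧ reaches y x) λ') + ∑ (allFin n) (λ x → when (isEnd x ∧ not (reaches y x)) 1#)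
      ≈⟨ +-cong (∑-unique (λ x → isEnd x ∧ reaches y x) (allFin n) (λ _ → λ') λ' oneEndReached (λ _ _ → refl)) (∑-when-const
          (λ x → isEnd x ∧ not (reaches y x)) (allFin n) 1#) ⟩
        λ' + natᴿ (count (λ x → isEnd x ∧ not (reaches y x)) (allFin n)) * 1#
      ≈⟨ +-cong refl (trans (*-identityʳ _) (reflexive (P.cong natᴿ #endsNotReached))) ⟩
        λ' + natᴿ k
      ∎
      where
        py : p u y ≡ nothing
        py = eqM-true sy
        x0 = proj₁ (end-exists py)
        oneEndReached : count (λ x → isEnd x ∧ reaches y x) (allFin n) ≡ 1
        oneEndReached = count-one _ x0 (∧-intro (P.trans (P.cong (λ z → eqM z nothing) (proj₁ (proj₂ (end-exists py)))) P.refl) (proj₂ (proj₂ (end-exists py))))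
               (λ x e → end-unique (eqM-true (∧-true₁ e)) (proj₁ (proj₂ (end-exists py))) (∧-true₂ {isEnd x} e) (proj₂ (proj₂ (end-exists py))))
        #endsNotReached : count (λ x → isEnd x ∧ not (reaches y x)) (allFin n) ≡ k
        #endsNotReached = NP.suc-injective (P.trans (P.trans (NP.+-comm 1 _)
            (P.cong₂ ℕ._+_ (count-cong (allFin n) (λ x → BP.∧-comm (isEnd x) (not (reaches y x)))) (P.sym
                (P.trans (count-cong (allFin n) (λ x → BP.∧-comm (reaches y x) (isEnd x))) oneEndReached))))
                   (P.trans (P.sym (count-splitBy (λ x → reaches y x) isEnd (allFin n))) #ends≡suc))

    ∑-starts : ∑ (allFin n) (λ y → when (isStart y) (b (startsAbove y) (startsBelow y))) ≈ bDiag R b k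
    ∑-starts = begin
        ∑ (allFin n) (λ y → when (isStart y) (b (startsAbove y) (startsBelow y)))
      ≈⟨ ∑-cong (allFin n) (λ y → when-cong (isStart y) (λ sy → reflexive (P.cong (λ z → b z (startsBelow y)) (startsAbove≡∸startsBelow k pk y sy)))) ⟩
        ∑ (allFin n) (λ y → when (isStart y) (b (k ∸ startsBelow y) (startsBelow y)))
      ≈⟨ ∑-byRank n isStart (λ r → b (k ∸ r) r) ⟩
        ∑< (count isStart (allFin n)) (λ r → b (k ∸ r) r)
      ≡⟨ P.cong (λ z → ∑< z (λ r → b (k ∸ r) r)) pk ⟩
        ∑< (suc k) (λ r → b (k ∸ r) r)
      ≈⟨ ∑<-reverse k (λ r → b (k ∸ r) r) ⟩
        ∑< (suc k) (λ r → b (k ∸ (k ∸ r)) (k ∸ r))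
      ≈⟨ ∑<-cong (suc k) (λ r r<sk → reflexive (P.cong (λ z → b z (k ∸ r)) (NP.m∸[m∸n]≡n (ℕ.s≤s⁻¹ r<sk)))) ⟩
        ∑< (suc k) (λ r → b r (k ∸ r))
      ∎

    ∑∑-addPeak : ∀ (W : Carrier) →
      ∑ (allFin n) (λ x → ∑ (allFin n) (λ y → when (isEnd x ∧ isStart y) ((powR R λ' (χ (reaches y x)) * b (startsAbove y) (startsBelow y)) * W)))
        ≈ ((λ' + natᴿ k) * bDiag R b k) * W
    ∑∑-addPeak W = begin
        ∑ (allFin n) (λ x → ∑ (allFin n) (λ y → when (isEnd x ∧ isStart y) ((cycleFactor x y * peakFactor y) * W)))
      ≈⟨ ∑-cong (allFin n) (λ x → ∑-cong (allFin n) (λ y → trans (when-∧ (isEnd x) (isStart y) _) (when-comm (isEnd x) (isStart y) _))) ⟩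
        ∑ (allFin n) (λ x → ∑ (allFin n) (λ y → when (isStart y) (when (isEnd x) ((cycleFactor x y * peakFactor y) * W))))
      ≈⟨ ∑-swap (allFin n) (allFin n) _ ⟩
        ∑ (allFin n) (λ y → ∑ (allFin n) (λ x → when (isStart y) (when (isEnd x) ((cycleFactor x y * peakFactor y) * W))))
      ≈⟨ ∑-cong (allFin n) (λ y → ∑-when (allFin n) (isStart y) _) ⟩
        ∑ (allFin n) (λ y → when (isStart y) (∑ (allFin n) (λ x → when (isEnd x) ((cycleFactor x y * peakFactor y) * W))))
      ≈⟨ ∑-cong (allFin n) (λ y → when-cong (isStart y) (λ sy → ∑-overEnds y sy)) ⟩
        ∑ (allFin n) (λ y → when (isStart y) ((λ' + natᴿ k) * (peakFactor y * W)))
      ≈⟨ ∑-cong (allFin n) (λ y → trans (sym (when-*ˡ (isStart y) _ _)) (*-cong refl (sym (when-*ʳ (isStart y) _ _)))) ⟩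
        ∑ (allFin n) (λ y → (λ' + natᴿ k) * (when (isStart y) (peakFactor y) * W))
      ≈⟨ sym (∑-*ˡ (allFin n) _ _) ⟩
        (λ' + natᴿ k) * ∑ (allFin n) (λ y → when (isStart y) (peakFactor y) * W)
      ≈⟨ *-cong refl (sym (∑-*ʳ (allFin n) W _)) ⟩
        (λ' + natᴿ k) * (∑ (allFin n) (λ y → when (isStart y) (peakFactor y)) * W)
      ≈⟨ *-cong refl (*-cong ∑-starts refl) ⟩
        (λ' + natᴿ k) * (bDiag R b k * W)
      ≈⟨ sym (*-assoc _ _ _) ⟩
        ((λ' + natᴿ k) * bDiag R b k) * W
      ∎
      where
        cycleFactor : Fin n → Fin n → Carrier
        cycleFactor x y = powR R λ' (χ (reaches y x))
        peakFactor : Fin n → Carrier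
        peakFactor y = b (startsAbove y) (startsBelow y)
        ∑-overEnds : ∀ y → isStart y ≡ true → ∑ (allFin n) (λ x → when (isEnd x) ((cycleFactor x y * peakFactor y) * W)) ≈ (λ' + natᴿ k) * (peakFactor y * W)
        ∑-overEnds y sy = begin
            ∑ (allFin n) (λ x → when (isEnd x) ((cycleFactor x y * peakFactor y) * W))
          ≈⟨ ∑-cong (allFin n) (λ x → trans (when-cong (isEnd x) (λ _ → *-assoc _ _ _)) (sym (when-*ʳ (isEnd x) _ _))) ⟩
            ∑ (allFin n) (λ x → when (isEnd x) (cycleFactor x y) * (peakFactor y * W))
          ≈⟨ sym (∑-*ʳ (allFin n) _ _) ⟩
            ∑ (allFin n) (λ x → when (isEnd x) (cycleFactor x y)) * (peakFactor y * W)
          ≈⟨ *-cong (∑-ends y sy) refl ⟩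
            (λ' + natᴿ k) * (peakFactor y * W)
          ∎

open PeakContribution

module Enumeration where

  sameMap : ∀ {n} → SuccMap n → SuccMap n → Bool
  sameMap {n} s t = allL (λ i → eqM (s i) (t i)) (allFin n)

  sameMap-true : ∀ {n} {s t : SuccMap n} → sameMap s t ≡ true → ∀ i → s i ≡ t i
  sameMap-true {s = s} {t} e i = eqM-true (allFin-all {P = λ i → eqM (s i) (t i)} e i)

  sameMap-intro : ∀ {n} {s t : SuccMap n} → (∀ i → s i ≡ t i) → sameMap s t ≡ true
  sameMap-intro {s = s} {t} h = allFin-intro {P = λ i → eqM (s i) (t i)} (λ i → P.subst (λ z → eqM (s i) z ≡ true) (h i) (eqM-refl (s i)))

  allL-tab : ∀ {A : Set} {n} (P : A → Bool) (f : Fin n → A) → allL P (tabulate f) ≡ allL (P ∘ f) (allFin n)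
  allL-tab {n = zero} P f = P.refl
  allL-tab {n = suc n} P f = P.cong (P (f Fin.zero) ∧_) (P.trans (allL-tab P (f ∘ Fin.suc)) (P.sym (allL-tab (P ∘ f) Fin.suc)))

  count-concatMap : ∀ {A B : Set} (Q : B → Bool) (g : A → List B) (xs : List A) → count Q (concatMap g xs) ≡ sumℕ xs (λ x → count Q (g x))
  count-concatMap Q g xs = P.trans (count≡sumℕ Q (concatMap g xs)) (P.trans (Sumℕ.fold-concatMap g xs (χ ∘ Q))
      (Sumℕ.fold-cong xs (λ x → P.sym (count≡sumℕ Q (g x)))))

  count-∧ˡ : ∀ {A : Set} (c : Bool) (Q : A → Bool) (xs : List A) → count (λ x → c ∧ Q x) xs ≡ (if c then count Q xs else 0)
  count-∧ˡ true Q xs = P.refl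
  count-∧ˡ false Q xs = count-false xs (λ _ → P.refl)

  count-allFuns : ∀ {M} (N : ℕ) (xs : List (Maybe (Fin M))) → (∀ v → count (eqM v) xs ≡ 1) →
                  (g : Fin N → Maybe (Fin M)) → count (λ f → allL (λ i → eqM (g i) (f i)) (allFin N)) (allFuns N xs) ≡ 1
  count-allFuns zero xs h g = P.refl
  count-allFuns (suc N) xs h g = P.trans (count-concatMap _ _ xs) (P.trans (Sumℕ.fold-cong xs (λ b → count-extensions b _ (λ f → P.refl) (λ f i → P.refl)))
      (P.trans (P.sym (count≡sumℕ _ xs)) (h (g Fin.zero))))
    where
      Q : (Fin (suc N) → Maybe (Fin _)) → Bool
      Q f = allL (λ i → eqM (g i) (f i)) (allFin (suc N))
      count-extensions : ∀ b (c : (Fin N → Maybe (Fin _)) → Fin (suc N) → Maybe (Fin _)) → (∀ f → c f Fin.zero ≡ b) → (∀ f i → c f (Fin.suc i) ≡ f i) →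
             count Q (map c (allFuns N xs)) ≡ χ (eqM (g Fin.zero) b)
      count-extensions b c h0 hs = P.trans (count-map Q c (allFuns N xs)) (P.trans (count-cong (allFuns N xs) (λ f → P.cong₂ _∧_ (P.cong (eqM (g Fin.zero)) (h0 f))
                  (P.trans (allL-tab {n = N} (λ i → eqM (g i) (c f i)) Fin.suc) (allL-cong (allFin N) (λ i → P.cong (eqM (g (Fin.suc i))) (hs f i))))))
                (P.trans (count-∧ˡ (eqM (g Fin.zero) b) _ (allFuns N xs)) (count-if (eqM (g Fin.zero) b))))
        where
          count-if : ∀ c → (if c then count (λ f → allL (λ i → eqM (g (Fin.suc i)) (f i)) (allFin N)) (allFuns N xs) else 0) ≡ χ c
          count-if true = count-allFuns N xs h (g ∘ Fin.suc)
          count-if false = P.refl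

  count-allExt-eqM : ∀ {n} (v : Maybe (Fin n)) → count (eqM v) (allExt n) ≡ 1
  count-allExt-eqM {n} nothing = P.cong suc (P.trans (count-map (eqM nothing) just (allFin n)) (count-false (allFin n) (λ _ → P.refl)))
  count-allExt-eqM {n} (just w) = P.trans (count-allExt (eqM (just w))) (P.trans (count-unique (eqF w) w (λ j ne → eqF-false (λ e → ne (P.sym e))))
      (P.cong χ (eqF-refl w)))

  allSuccMaps : (n : ℕ) → List (SuccMap n)
  allSuccMaps n = allFuns n (allExt n)

  count-allSuccMaps : ∀ {n} (g : SuccMap n) → count (sameMap g) (allSuccMaps n) ≡ 1
  count-allSuccMaps {n} g = count-allFuns n (allExt n) count-allExt-eqM g

  inLD : ∀ {n} → ℕ → SuccMap n → Bool
  inLD k s = isLaguerre s ∧ isAlternating s ∧ ⌊ paths s ℕ.≟ k ⌋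

  ≟-true : ∀ {m k} → ⌊ m ℕ.≟ k ⌋ ≡ true → m ≡ k
  ≟-true {m} {k} e with m ℕ.≟ k
  ... | yes q = q

  ≟-intro : ∀ {m k} → m ≡ k → ⌊ m ℕ.≟ k ⌋ ≡ true
  ≟-intro {m} {k} q with m ℕ.≟ k
  ... | yes _ = P.refl
  ... | no nq = ⊥-elim (nq q)

  inLD-cong : ∀ {n} k {s t : SuccMap n} → (∀ i → s i ≡ t i) → inLD k s ≡ inLD k t
  inLD-cong k {s} {t} e = P.cong₂ _∧_ isLaguerre-cong (P.cong₂ _∧_ isAlternating-cong (P.cong (λ z → ⌊ z ℕ.≟ k ⌋) paths-cong))
    where open Cong s t e

  module Reindex {c ℓ : Level} (R : CommutativeSemiring c ℓ) where
    open CommutativeSemiring R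
    open Semi R
    open import Relation.Binary.Reasoning.Setoid setoid

    -- Both sides equal the double sum over the pairs (a , m) with embed m identified with a.
    reindex : ∀ {A B : Set} (L : List A) (M : List B) (V : A → Bool) (U : B → Bool) (embed : B → A) (same : A → A → Bool) (Φ : A → Carrier) →
      (∀ m → U m ≡ true → count (same (embed m)) L ≡ 1) →
      (∀ m a → U m ≡ true → same (embed m) a ≡ true → Φ a ≈ Φ (embed m)) →
      (∀ a → V a ≡ true → count (λ m → U m ∧ same (embed m) a) M ≡ 1) →
      (∀ m a → U m ≡ true → same (embed m) a ≡ true → V a ≡ true) →
      ∑ L (λ a → when (V a) (Φ a)) ≈ ∑ M (λ m → when (U m) (Φ (embed m)))
    reindex L M V U embed same Φ image-unique Φ-resp preimage-unique image-in = begin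
        ∑ L (λ a → when (V a) (Φ a))
      ≈⟨ ∑-cong L expand ⟩
        ∑ L (λ a → ∑ M (λ m → when (U m ∧ same (embed m) a) (Φ a)))
      ≈⟨ ∑-swap L M _ ⟩
        ∑ M (λ m → ∑ L (λ a → when (U m ∧ same (embed m) a) (Φ a)))
      ≈⟨ ∑-cong M collapse ⟩
        ∑ M (λ m → when (U m) (Φ (embed m)))
      ∎
      where
        expand : ∀ a → when (V a) (Φ a) ≈ ∑ M (λ m → when (U m ∧ same (embed m) a) (Φ a))
        expand a with V a in va
        ... | true = sym (∑-unique (λ m → U m ∧ same (embed m) a) M (λ _ → Φ a) (Φ a) (preimage-unique a va) (λ _ _ → refl))
        ... | false = sym (∑-none (λ m → U m ∧ same (embed m) a) M (λ _ → Φ a) (count-false M lem))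
          where
            lem : ∀ m → (U m ∧ same (embed m) a) ≡ false
            lem m = ≢true (λ e → t≢f (P.trans (P.sym (image-in m a (∧-true₁ e) (∧-true₂ {U m} e))) va))
        collapse : ∀ m → ∑ L (λ a → when (U m ∧ same (embed m) a) (Φ a)) ≈ when (U m) (Φ (embed m))
        collapse m with U m in um
        ... | true = ∑-unique (same (embed m)) L Φ (Φ (embed m)) (image-unique m um) (λ a e → Φ-resp m a um e)
        ... | false = ∑-0 L

open Enumeration

module Recurrence where

  caseLast-cong : ∀ {n} {A : Set} {f g : Fin n → A} (a : A) → (∀ i → f i ≡ g i) → ∀ j → caseLast f a j ≡ caseLast g a j
  caseLast-cong {zero} a h j = P.refl
  caseLast-cong {suc n} a h Fin.zero = h Fin.zero
  caseLast-cong {suc n} a h (Fin.suc j) = caseLast-cong a (λ i → h (Fin.suc i)) j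

  addIsolated-cong : ∀ {n} {u v : SuccMap n} → (∀ i → u i ≡ v i) → ∀ j → addIsolated u j ≡ addIsolated v j
  addIsolated-cong h = caseLast-cong nothing (λ i → P.cong lift (h i))

  addPeak-cong : ∀ {n} {u v : SuccMap n} (x y : Fin n) → (∀ i → u i ≡ v i) → ∀ j → addPeak u x y j ≡ addPeak v x y j
  addPeak-cong x y h = caseLast-cong _ (λ i → P.cong (λ z → if eqF i x then just (ℓ _) else lift z) (h i))

  is∞ : ∀ {n} → Maybe (Fin n) → Bool
  is∞ v = eqM v nothing

  ≟-suc : ∀ m k → ⌊ suc m ℕ.≟ suc k ⌋ ≡ ⌊ m ℕ.≟ k ⌋
  ≟-suc m k = bool-ext (λ e → ≟-intro (NP.suc-injective (≟-true e))) (λ e → ≟-intro (P.cong suc (≟-true e)))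

  admitsIsolated : ∀ {n} → ℕ → SuccMap n → Bool
  admitsIsolated k u = isLaguerre u ∧ isAlternating u ∧ ⌊ suc (paths u) ℕ.≟ k ⌋

  admitsIsolated-zero : ∀ {n} (u : SuccMap n) → admitsIsolated zero u ≡ false
  admitsIsolated-zero u = P.trans (P.cong (isLaguerre u ∧_) (BP.∧-zeroʳ _)) (BP.∧-zeroʳ _)

  admitsIsolated-suc : ∀ {n} k (u : SuccMap n) → admitsIsolated (suc k) u ≡ inLD k u
  admitsIsolated-suc k u = P.cong (λ z → isLaguerre u ∧ isAlternating u ∧ z) (≟-suc (paths u) k)

  admitsIsolated-cong : ∀ {n} k {s t : SuccMap n} → (∀ i → s i ≡ t i) → admitsIsolated k s ≡ admitsIsolated k t
  admitsIsolated-cong k {s} {t} e = P.cong₂ _∧_ isLaguerre-cong (P.cong₂ _∧_ isAlternating-cong (P.cong (λ z → ⌊ suc z ℕ.≟ k ⌋) paths-cong))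
    where open Cong s t e

  laguerreAlt-parts : ∀ {n m k} (s : SuccMap n) → (isLaguerre s ∧ isAlternating s ∧ ⌊ m ℕ.≟ k ⌋) ≡ true →
                      Injective s × isAlternating s ≡ true × m ≡ k
  laguerreAlt-parts s e with isLaguerre s in lag | isAlternating s
  ... | true | true = isLaguerre⇒Injective s lag , P.refl , ≟-true e

  laguerreAlt-intro : ∀ {n m k} {s : SuccMap n} → Injective s → isAlternating s ≡ true → m ≡ k →
                      (isLaguerre s ∧ isAlternating s ∧ ⌊ m ℕ.≟ k ⌋) ≡ true
  laguerreAlt-intro {s = s} inj alt m≡k rewrite Injective⇒isLaguerre s inj | alt = ≟-intro m≡k

  dropLast-addIsolated : ∀ {n} (u : SuccMap n) i → dropLast (addIsolated u) i ≡ u i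
  dropLast-addIsolated u i = P.trans (P.cong unlift (caseLast-ι (lift ∘ u) nothing i)) (unlift-lift (u i))

  addPeak-ℓ : ∀ {n} (u : SuccMap n) x y → addPeak u x y (ℓ n) ≡ just (ι y)
  addPeak-ℓ {n} u x y = caseLast-ℓ (λ i → if eqF i x then just (ℓ n) else lift (u i)) (just (ι y))

  addPeak-ιx : ∀ {n} (u : SuccMap n) x y → addPeak u x y (ι x) ≡ just (ℓ n)
  addPeak-ιx u x y = P.trans (caseLast-ι _ (just (ι y)) x) (if-eqF-refl x _ _)

  dropLast-addPeak : ∀ {n} (u : SuccMap n) x y → u x ≡ nothing → ∀ i → dropLast (addPeak u x y) i ≡ u i
  dropLast-addPeak {n} u x y ux i = P.trans (P.cong unlift (caseLast-ι f (just (ι y)) i)) (unlift-branch (eqF i x) P.refl)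
    where
      f : Fin n → Maybe (Fin (suc n))
      f j = if eqF j x then just (ℓ n) else lift (u j)
      unlift-branch : ∀ b → eqF i x ≡ b → unlift (if b then just (ℓ n) else lift (u i)) ≡ u i
      unlift-branch true e = P.trans (caseLast-ℓ just nothing) (P.sym (P.trans (P.cong u (eqF-true e)) ux))
      unlift-branch false _ = unlift-lift (u i)

  PeakInsertion : ℕ → Set
  PeakInsertion n = SuccMap n × Fin n × Fin n

  peakInsertions : ∀ n → List (PeakInsertion n)
  peakInsertions n = concatMap (λ u → concatMap (λ x → map (λ y → (u , x , y)) (allFin n)) (allFin n)) (allSuccMaps n)

  admitsPeak : ∀ {n} → ℕ → PeakInsertion n → Bool
  admitsPeak k (u , x , y) = inLD (suc k) u ∧ (eqM (u x) nothing ∧ eqM (p u y) nothing)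

  addPeak′ : ∀ {n} → PeakInsertion n → SuccMap (suc n)
  addPeak′ (u , x , y) = addPeak u x y

  count-peakInsertions : ∀ {n} (Q : PeakInsertion n → Bool) → count Q (peakInsertions n) ≡ sumℕ (allSuccMaps n) (λ u → sumℕ (allFin n)
      (λ x → count (λ y → Q (u , x , y)) (allFin n)))
  count-peakInsertions {n} Q = P.trans (count-concatMap Q _ (allSuccMaps n)) (Sumℕ.fold-cong (allSuccMaps n) (λ u → P.trans (count-concatMap Q _ (allFin n))
                      (Sumℕ.fold-cong (allFin n) (λ x → count-map Q _ (allFin n)))))

  module IsolatedLastBijection (n k : ℕ) where
    addIsolated-inLD : ∀ u → admitsIsolated k u ≡ true →
                       (inLD k (addIsolated u) ∧ is∞ (addIsolated u (ℓ n))) ≡ true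
    addIsolated-inLD u e = ∧-intro (laguerreAlt-intro addIsolated-inj alternating paths≡k) (P.cong is∞ addIsolated-ℓ)
      where
        parts = laguerreAlt-parts u e
        open AddIsolated u (proj₁ parts)
        open Invariance (addIsolated u) u compat
        alternating : isAlternating (addIsolated u) ≡ true
        alternating = P.trans isAlternating-inv (∧-intro (proj₁ (proj₂ parts)) alternating-ℓ)
        paths≡k : paths (addIsolated u) ≡ k
        paths≡k = P.trans paths-addIsolated (P.trans (NP.+-comm (paths u) 1) (proj₂ (proj₂ parts)))

    image-inLD : ∀ u t → admitsIsolated k u ≡ true → sameMap (addIsolated u) t ≡ true →
                 (inLD k t ∧ is∞ (t (ℓ n))) ≡ true
    image-inLD u t e q = P.trans (P.sym (P.cong₂ _∧_ (inLD-cong k u≗t) (P.cong is∞ (u≗t (ℓ n))))) (addIsolated-inLD u e)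
      where
        u≗t = sameMap-true {s = addIsolated u} {t} q

    preimage-unique : ∀ t → (inLD k t ∧ is∞ (t (ℓ n))) ≡ true →
                      count (λ u → admitsIsolated k u ∧ sameMap (addIsolated u) t) (allSuccMaps n) ≡ 1
    preimage-unique t e = P.trans (count-cong (allSuccMaps n) preimage-iff) (count-allSuccMaps (dropLast t))
      where
        parts = laguerreAlt-parts t (∧-true₁ e)
        open DropLast t (proj₁ parts) (proj₁ (proj₂ parts))
        open IsolatedLast (eqM-true (∧-true₂ {inLD k t} e))
        dropLast-admits : admitsIsolated k (dropLast t) ≡ true
        dropLast-admits = laguerreAlt-intro dropLast-inj dropLast-alternating (begin
            suc (paths (dropLast t))          ≡⟨ NP.+-comm 1 (paths (dropLast t)) ⟩
            paths (dropLast t) ℕ.+ 1            ≡⟨ P.sym (AddIsolated.paths-addIsolated (dropLast t) dropLast-inj) ⟩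
            paths (addIsolated (dropLast t))  ≡⟨ Cong.paths-cong (addIsolated (dropLast t)) t addIsolated-dropLast ⟩
            paths t                           ≡⟨ proj₂ (proj₂ parts) ⟩
            k                                 ∎)
          where open P.≡-Reasoning
        preimage-iff : ∀ u → (admitsIsolated k u ∧ sameMap (addIsolated u) t) ≡ sameMap (dropLast t) u
        preimage-iff u = bool-ext to from
          where
            to : (admitsIsolated k u ∧ sameMap (addIsolated u) t) ≡ true → sameMap (dropLast t) u ≡ true
            to q = sameMap-intro (λ i → P.trans (P.cong unlift (P.sym (u≗t (ι i)))) (dropLast-addIsolated u i))
              where
                u≗t = sameMap-true {s = addIsolated u} {t} (∧-true₂ {admitsIsolated k u} q)
            from : sameMap (dropLast t) u ≡ true → (admitsIsolated k u ∧ sameMap (addIsolated u) t) ≡ true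
            from q = ∧-intro (P.trans (P.sym (admitsIsolated-cong k t≗u)) dropLast-admits)
                             (sameMap-intro (λ j → P.trans (addIsolated-cong (λ i → P.sym (t≗u i)) j) (addIsolated-dropLast j)))
              where
                t≗u = sameMap-true {s = dropLast t} {u} q

  module PeakLastBijection (n k : ℕ) where
    addPeak-inLD : ∀ m → admitsPeak k m ≡ true → (inLD k (addPeak′ m) ∧ not (is∞ (addPeak′ m (ℓ n)))) ≡ true
    addPeak-inLD (u , x , y) e = ∧-intro (laguerreAlt-intro t-inj alternating paths≡k) (P.cong (not ∘ is∞) tℓ)
      where
        parts = laguerreAlt-parts u (∧-true₁ e)
        endpoints = ∧-true₂ {inLD (suc k) u} e
        open AddPeak u x y (proj₁ parts) (eqM-true (∧-true₁ endpoints)) (eqM-true (∧-true₂ {eqM (u x) nothing} endpoints))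
        open Invariance (addPeak u x y) u compat
        alternating : isAlternating (addPeak u x y) ≡ true
        alternating = P.trans isAlternating-inv (∧-intro (proj₁ (proj₂ parts)) alternating-ℓ)
        paths≡k : paths (addPeak u x y) ≡ k
        paths≡k = NP.suc-injective (P.trans (NP.+-comm 1 (paths (addPeak u x y))) (P.trans paths-addPeak (proj₂ (proj₂ parts))))

    image-inLD : ∀ m t → admitsPeak k m ≡ true → sameMap (addPeak′ m) t ≡ true → (inLD k t ∧ not (is∞ (t (ℓ n)))) ≡ true
    image-inLD m t e q = P.trans (P.sym (P.cong₂ _∧_ (inLD-cong k m≗t) (P.cong (not ∘ is∞) (m≗t (ℓ n))))) (addPeak-inLD m e)
      where
        m≗t = sameMap-true {s = addPeak′ m} {t} q

    preimage-unique : ∀ t → (inLD k t ∧ not (is∞ (t (ℓ n)))) ≡ true →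
                      count (λ m → admitsPeak k m ∧ sameMap (addPeak′ m) t) (peakInsertions n) ≡ 1
    preimage-unique t e = begin
        count (λ m → admitsPeak k m ∧ sameMap (addPeak′ m) t) (peakInsertions n)
      ≡⟨ count-peakInsertions {n} (λ m → admitsPeak k m ∧ sameMap (addPeak′ m) t) ⟩
        sumℕ (allSuccMaps n) (λ u → sumℕ (allFin n) (λ x → count (λ y → admitsPeak k (u , x , y) ∧ sameMap (addPeak u x y) t) (allFin n)))
      ≡⟨ sumℕ-cong (allSuccMaps n) count-preimages ⟩
        sumℕ (allSuccMaps n) (λ u → χ (sameMap (dropLast t) u))
      ≡⟨ P.sym (count≡sumℕ _ (allSuccMaps n)) ⟩
        count (sameMap (dropLast t)) (allSuccMaps n)
      ≡⟨ count-allSuccMaps (dropLast t) ⟩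
        1
      ∎
      where
        open P.≡-Reasoning
        parts = laguerreAlt-parts t (∧-true₁ e)
        lastSucc : ∃ λ w' → t (ℓ n) ≡ just w'
        lastSucc with t (ℓ n)
        ... | just w' = w' , P.refl
        ... | nothing = ⊥-elim (t≢f (P.sym (∧-true₂ {inLD k t} e)))
        open DropLast t (proj₁ parts) (proj₁ (proj₂ parts))
        open PeakLast (proj₂ lastSucc) renaming (x to x₀; y to y₀)
        paths-dropLast : paths (dropLast t) ≡ suc k
        paths-dropLast = begin
            paths (dropLast t)                         ≡⟨ P.sym (AddPeak.paths-addPeak (dropLast t) x₀ y₀ dropLast-inj rx py) ⟩
            paths (addPeak (dropLast t) x₀ y₀) ℕ.+ 1   ≡⟨ P.cong (λ z → z ℕ.+ 1) (Cong.paths-cong (addPeak (dropLast t) x₀ y₀) t addPeak-dropLast) ⟩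
            paths t ℕ.+ 1                              ≡⟨ P.cong (λ z → z ℕ.+ 1) (proj₂ (proj₂ parts)) ⟩
            k ℕ.+ 1                                    ≡⟨ NP.+-comm k 1 ⟩
            suc k                                      ∎
        to : ∀ u x y → (admitsPeak k (u , x , y) ∧ sameMap (addPeak u x y) t) ≡ true →
             ((sameMap (dropLast t) u ∧ eqF x x₀) ∧ eqF y y₀) ≡ true
        to u x y q = ∧-intro (∧-intro (sameMap-intro dropLast≗u) (eqF-intro x≡x₀)) (eqF-intro y≡y₀)
          where
            m≗t = sameMap-true {s = addPeak u x y} {t} (∧-true₂ {admitsPeak k (u , x , y)} q)
            ux : u x ≡ nothing
            ux = eqM-true (∧-true₁ (∧-true₂ {inLD (suc k) u} (∧-true₁ q)))
            y≡y₀ : y ≡ y₀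
            y≡y₀ = ι-inj (just-inj (P.trans (P.sym (addPeak-ℓ u x y)) (P.trans (m≗t (ℓ n)) ty)))
            x≡x₀ : x ≡ x₀
            x≡x₀ = ι-inj (proj₁ parts (ι x) (ι x₀) (ℓ n) (P.trans (P.sym (m≗t (ι x))) (addPeak-ιx u x y)) tx)
            dropLast≗u : ∀ i → dropLast t i ≡ u i
            dropLast≗u i = P.trans (P.cong unlift (P.sym (m≗t (ι i)))) (dropLast-addPeak u x y ux i)
        from : ∀ u → sameMap (dropLast t) u ≡ true → (admitsPeak k (u , x₀ , y₀) ∧ sameMap (addPeak u x₀ y₀) t) ≡ true
        from u q = ∧-intro (∧-intro u-inLD (∧-intro x₀-end y₀-start)) (sameMap-intro addPeak≗t)
          where
            t≗u = sameMap-true {s = dropLast t} {u} q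
            u-inLD = P.trans (P.sym (inLD-cong (suc k) t≗u)) (laguerreAlt-intro dropLast-inj dropLast-alternating paths-dropLast)
            x₀-end = P.cong is∞ (P.trans (P.sym (t≗u x₀)) rx)
            y₀-start = P.cong is∞ (P.trans (P.sym (Cong.p-cong (dropLast t) u t≗u y₀)) py)
            addPeak≗t : ∀ j → addPeak u x₀ y₀ j ≡ t j
            addPeak≗t j = P.trans (addPeak-cong x₀ y₀ (λ i → P.sym (t≗u i)) j) (addPeak-dropLast j)
        preimage-iff : ∀ u x y → (admitsPeak k (u , x , y) ∧ sameMap (addPeak u x y) t) ≡ ((sameMap (dropLast t) u ∧ eqF x x₀) ∧ eqF y y₀)
        preimage-iff u x y = bool-ext (to u x y) back
          where
            back : ((sameMap (dropLast t) u ∧ eqF x x₀) ∧ eqF y y₀) ≡ true → (admitsPeak k (u , x , y) ∧ sameMap (addPeak u x y) t) ≡ true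
            back q = P.subst₂ (λ x y → (admitsPeak k (u , x , y) ∧ sameMap (addPeak u x y) t) ≡ true)
                       (P.sym (eqF-true (∧-true₂ {sameMap (dropLast t) u} (∧-true₁ q))))
                       (P.sym (eqF-true (∧-true₂ {sameMap (dropLast t) u ∧ eqF x x₀} q)))
                       (from u (∧-true₁ (∧-true₁ q)))
        count-preimages : ∀ u → sumℕ (allFin n) (λ x → count (λ y → admitsPeak k (u , x , y) ∧ sameMap (addPeak u x y) t) (allFin n))
                                ≡ χ (sameMap (dropLast t) u)
        count-preimages u = begin
            sumℕ (allFin n) (λ x → count (λ y → admitsPeak k (u , x , y) ∧ sameMap (addPeak u x y) t) (allFin n))
          ≡⟨ sumℕ-cong (allFin n) (λ x → P.trans (count-cong (allFin n) (preimage-iff u x)) (count-∧-eqF _ y₀)) ⟩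
            sumℕ (allFin n) (λ x → χ (sameMap (dropLast t) u ∧ eqF x x₀))
          ≡⟨ P.sym (count≡sumℕ _ (allFin n)) ⟩
            count (λ x → sameMap (dropLast t) u ∧ eqF x x₀) (allFin n)
          ≡⟨ count-∧-eqF _ x₀ ⟩
            χ (sameMap (dropLast t) u)
          ∎

  module Decomposition {c ℓ' : Level} (R : CommutativeSemiring c ℓ') (a : ℕ → CommutativeSemiring.Carrier R)
                       (b : ℕ → ℕ → CommutativeSemiring.Carrier R) (λ' : CommutativeSemiring.Carrier R) where
    open CommutativeSemiring R hiding (zero)
    open Semi R
    open Reindex R
    open Weight R a b λ'
    open import Relation.Binary.Reasoning.Setoid setoid

    w : ∀ {N} → SuccMap N → Carrier
    w = weight R a b λ'

    w-cong : ∀ {N} (s t : SuccMap N) → (∀ i → s i ≡ t i) → w s ≈ w t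
    w-cong s t e = reflexive (Cong.weight-cong s t e R a b λ')

    Qt≈∑ : ∀ n k → Qt R a b λ' n k ≈ ∑ (allSuccMaps n) (λ s → when (inLD k s) (w s))
    Qt≈∑ n k = ∑-filter (inLD k) (allSuccMaps n) w

    ∑-isolatedLast : ∀ n k → ∑ (allSuccMaps (suc n)) (λ t → when (inLD k t ∧ is∞ (t (ℓ n))) (w t))
                           ≈ ∑ (allSuccMaps n) (λ u → when (admitsIsolated k u) (w (addIsolated u)))
    ∑-isolatedLast n k = reindex (allSuccMaps (suc n)) (allSuccMaps n) (λ t → inLD k t ∧ is∞ (t (ℓ n))) (admitsIsolated k)
                                 addIsolated sameMap w
        (λ u _ → count-allSuccMaps (addIsolated u))
        (λ u t _ e → sym (w-cong (addIsolated u) t (sameMap-true {s = addIsolated u} {t} e)))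
        (IsolatedLastBijection.preimage-unique n k) (IsolatedLastBijection.image-inLD n k)

    ∑-addIsolated : ∀ n k → ∑ (allSuccMaps n) (λ u → when (admitsIsolated k u) (w (addIsolated u))) ≈ firstTerm R a b λ' n k
    ∑-addIsolated n zero = trans (∑-cong (allSuccMaps n) (λ u → reflexive (P.cong (λ z → when z (w (addIsolated u))) (admitsIsolated-zero u))))
                                 (∑-0 (allSuccMaps n))
    ∑-addIsolated n (suc k) = begin
        ∑ (allSuccMaps n) (λ u → when (admitsIsolated (suc k) u) (w (addIsolated u)))
      ≈⟨ ∑-cong (allSuccMaps n) (λ u → trans (reflexive (P.cong (λ z → when z (w (addIsolated u))) (admitsIsolated-suc k u)))
                                             (when-cong (inLD k u) (weight-addIsolated-inLD u))) ⟩
        ∑ (allSuccMaps n) (λ u → when (inLD k u) (a k * w u))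
      ≈⟨ ∑-cong (allSuccMaps n) (λ u → sym (when-*ˡ (inLD k u) (a k) (w u))) ⟩
        ∑ (allSuccMaps n) (λ u → a k * when (inLD k u) (w u))
      ≈⟨ sym (∑-*ˡ (allSuccMaps n) (a k) _) ⟩
        a k * ∑ (allSuccMaps n) (λ u → when (inLD k u) (w u))
      ≈⟨ *-cong refl (sym (Qt≈∑ n k)) ⟩
        a k * Qt R a b λ' n k
      ∎
      where
        weight-addIsolated-inLD : ∀ u → inLD k u ≡ true → w (addIsolated u) ≈ a k * w u
        weight-addIsolated-inLD u e = trans (weight-addIsolated u inj) (*-congʳ (reflexive (P.cong a #ends≡k)))
          where
            parts = laguerreAlt-parts u e
            inj = proj₁ parts
            #ends≡k = P.trans (Ends.#ends≡#starts u inj) (proj₂ (proj₂ parts))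

    ∑-peakLast : ∀ n k → ∑ (allSuccMaps (suc n)) (λ t → when (inLD k t ∧ not (is∞ (t (ℓ n)))) (w t))
                       ≈ ∑ (peakInsertions n) (λ m → when (admitsPeak k m) (w (addPeak′ m)))
    ∑-peakLast n k = reindex (allSuccMaps (suc n)) (peakInsertions n) (λ t → inLD k t ∧ not (is∞ (t (ℓ n)))) (admitsPeak k)
                             addPeak′ sameMap w
        (λ m _ → count-allSuccMaps (addPeak′ m))
        (λ m t _ e → sym (w-cong (addPeak′ m) t (sameMap-true {s = addPeak′ m} {t} e)))
        (PeakLastBijection.preimage-unique n k) (PeakLastBijection.image-inLD n k)

    ∑-addPeak : ∀ n k → ∑ (peakInsertions n) (λ m → when (admitsPeak k m) (w (addPeak′ m))) ≈ ((λ' + natR R k) * bDiag R b k) * Qt R a b λ' n (suc k)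
    ∑-addPeak n k = begin
        ∑ (peakInsertions n) (λ m → when (admitsPeak k m) (w (addPeak′ m)))
      ≈⟨ ∑-concatMap _ (allSuccMaps n) _ ⟩
        ∑ (allSuccMaps n) (λ u → ∑ (concatMap (λ x → map (λ y → (u , x , y)) (allFin n)) (allFin n)) (λ m → when (admitsPeak k m) (w (addPeak′ m))))
      ≈⟨ ∑-cong (allSuccMaps n) (λ u → trans (∑-concatMap _ (allFin n) _) (∑-cong (allFin n) (λ x → reflexive (∑-map _ (allFin n) _)))) ⟩
        ∑ (allSuccMaps n) (λ u → ∑ (allFin n) (λ x → ∑ (allFin n) (λ y → when (admitsPeak k (u , x , y)) (w (addPeak u x y)))))
      ≈⟨ ∑-cong (allSuccMaps n) ∑-insertionsInto ⟩
        ∑ (allSuccMaps n) (λ u → when (inLD (suc k) u) (C * w u))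
      ≈⟨ ∑-cong (allSuccMaps n) (λ u → sym (when-*ˡ (inLD (suc k) u) C (w u))) ⟩
        ∑ (allSuccMaps n) (λ u → C * when (inLD (suc k) u) (w u))
      ≈⟨ sym (∑-*ˡ (allSuccMaps n) C _) ⟩
        C * ∑ (allSuccMaps n) (λ u → when (inLD (suc k) u) (w u))
      ≈⟨ *-cong refl (sym (Qt≈∑ n (suc k))) ⟩
        C * Qt R a b λ' n (suc k)
      ∎
      where
        C : Carrier
        C = (λ' + natR R k) * bDiag R b k
        ∑-insertionsInto : ∀ u → ∑ (allFin n) (λ x → ∑ (allFin n) (λ y → when (admitsPeak k (u , x , y)) (w (addPeak u x y)))) ≈ when (inLD (suc k) u) (C * w u)
        ∑-insertionsInto u = begin
            ∑ (allFin n) (λ x → ∑ (allFin n) (λ y → when (admitsPeak k (u , x , y)) (w (addPeak u x y))))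
          ≈⟨ ∑-cong (allFin n) (λ x → ∑-cong (allFin n) (λ y → when-∧ (inLD (suc k) u) _ _)) ⟩
            ∑ (allFin n) (λ x → ∑ (allFin n) (λ y → when (inLD (suc k) u) (when (eqM (u x) nothing ∧ eqM (p u y) nothing) (w (addPeak u x y)))))
          ≈⟨ ∑-cong (allFin n) (λ x → ∑-when (allFin n) (inLD (suc k) u) _) ⟩
            ∑ (allFin n) (λ x → when (inLD (suc k) u) (∑ (allFin n) (λ y → when (eqM (u x) nothing ∧ eqM (p u y) nothing) (w (addPeak u x y)))))
          ≈⟨ ∑-when (allFin n) (inLD (suc k) u) _ ⟩
            when (inLD (suc k) u) (∑ (allFin n) (λ x → ∑ (allFin n) (λ y → when (eqM (u x) nothing ∧ eqM (p u y) nothing) (w (addPeak u x y)))))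
          ≈⟨ when-cong (inLD (suc k) u) ∑-insertionsInto-inLD ⟩
            when (inLD (suc k) u) (C * w u)
          ∎
          where
            ∑-insertionsInto-inLD : inLD (suc k) u ≡ true → ∑ (allFin n) (λ x → ∑ (allFin n)
                (λ y → when (eqM (u x) nothing ∧ eqM (p u y) nothing) (w (addPeak u x y)))) ≈ C * w u
            ∑-insertionsInto-inLD e = trans (∑-cong (allFin n) (λ x → ∑-cong (allFin n) (λ y → when-cong (eqM (u x) nothing ∧ eqM (p u y) nothing)
                           (λ q → weight-addPeak u x y inj (eqM-true (∧-true₁ q)) (eqM-true (∧-true₂ {eqM (u x) nothing} q))))))
                           (PeakContribution.PeakSum.∑∑-addPeak R b λ' u inj k (proj₂ (proj₂ parts)) (w u))
              where
                parts = laguerreAlt-parts u e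
                inj = proj₁ parts

open Recurrence

proposition6p5 : {c ℓ : Level} (R : CommutativeSemiring c ℓ) →
    (a : ℕ → CommutativeSemiring.Carrier R) (b : ℕ → ℕ → CommutativeSemiring.Carrier R)
    (λ' : CommutativeSemiring.Carrier R) (n k : ℕ) →
    CommutativeSemiring._≈_ R (Qt R a b λ' (suc n) k)
      (CommutativeSemiring._+_ R (firstTerm R a b λ' n k)
        (CommutativeSemiring._*_ R
          (CommutativeSemiring._*_ R (CommutativeSemiring._+_ R λ' (natR R k)) (bDiag R b k))
          (Qt R a b λ' n (suc k))))
proposition6p5 R a b λ' n k = begin
    Qt R a b λ' (suc n) k
  ≈⟨ Qt≈∑ (suc n) k ⟩
    ∑ maps (λ t → when (inLD k t) (w t))
  ≈⟨ ∑-cong maps (λ t → when-split (inLD k t) (noSuccAtLast t) (w t)) ⟩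
    ∑ maps (λ t → when (inLD k t ∧ noSuccAtLast t) (w t) + when (inLD k t ∧ not (noSuccAtLast t)) (w t))
  ≈⟨ ∑-+ maps _ _ ⟩
    ∑ maps (λ t → when (inLD k t ∧ noSuccAtLast t) (w t)) + ∑ maps (λ t → when (inLD k t ∧ not (noSuccAtLast t)) (w t))
  ≈⟨ +-cong (trans (∑-isolatedLast n k) (∑-addIsolated n k)) (trans (∑-peakLast n k) (∑-addPeak n k)) ⟩
    firstTerm R a b λ' n k + ((λ' + natR R k) * bDiag R b k) * Qt R a b λ' n (suc k)
  ∎
  where
    open CommutativeSemiring R hiding (zero)
    open Sums.Semi R
    open Decomposition R a b λ'
    open import Relation.Binary.Reasoning.Setoid setoid
    maps : List (SuccMap (suc n))
    maps = allSuccMaps (suc n)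

    noSuccAtLast : SuccMap (suc n) → Bool
    noSuccAtLast t = is∞ (t (ℓ n))
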